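{- Let $n\geq 2$. There is a bijection $$\varPhi: \bigcup_{1\leq k\leq \lfloor n/2\rfloor}\mathcal{HM}_{n,k}\to\bigcup_{0\leq k\leq n-2}\mathcal{S}_k(2,1;n).$$
   Context: A Motzkin path of order $n$ is a lattice path from $(0,0)$ to $(n,0)$ using up steps $(1,1)$, down steps $(1,-1)$ and flat steps $(1,0)$ that never goes below the $x$-axis. A hump is a consecutive sequence of steps of a Motzkin path consisting of an up step, followed by zero or more flat steps, followed by a down step; its height is the $y$-coordinate reached by its up step. $\mathcal{HM}_{n,k}$ is the set of pairs $(M,P)$ with $M$ a Motzkin path of order $n$ and $P$ a hump of $M$ of height $k$. $\mathcal{S}_k(2,1;n)$ is the set of standard Young tableaux whose shape is a partition $\lambda$ of $n$ with $\lambda_3\leq 1$ (a $(2,1)$-hook, i.e. $\lambda=(\lambda_1,\lambda_2,1,\dots,1)$) and $\lambda_1-\lambda_2=k$. -}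

module Defs where

open import Data.Nat using (ℕ; zero; suc; _+_; _∸_; _≤_; _<_; _≥_; _/_; _≟_)
open import Data.Unit using (⊤)
open import Data.Empty using (⊥)
open import Data.Product using (Σ; _×_; _,_)
open import Data.List using (List; []; _∷_; _++_; replicate; length; map; concat; filter; applyUpTo)
open import Data.List.Relation.Unary.All using (All)
open import Data.List.Relation.Unary.Linked using (Linked)
open import Relation.Binary.PropositionalEquality using (_≡_)

data Step : Set where
  U D F : Step   -- up (1,1), down (1,-1), flat (1,0)

ValidFrom : ℕ → List Step → Set
ValidFrom h       []      = h ≡ 0
ValidFrom h       (U ∷ s) = ValidFrom (suc h) s
ValidFrom zero    (D ∷ s) = ⊥
ValidFrom (suc h) (D ∷ s) = ValidFrom h s
ValidFrom h       (F ∷ s) = ValidFrom h s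

IsMotzkin : ℕ → List Step → Set
IsMotzkin n M = length M ≡ n × ValidFrom 0 M

walk : ℕ → List Step → ℕ
walk h []      = h
walk h (U ∷ s) = walk (suc h) s
walk h (D ∷ s) = walk (h ∸ 1) s
walk h (F ∷ s) = walk h s

-- A hump of M, given by its position: M = A ++ U F^f D ++ B.
-- Its height is the y-coordinate reached by its up step, i.e. walk 0 A + 1.
record Hump (M : List Step) : Set where
  constructor hump
  field
    before : List Step
    flats  : ℕ
    after  : List Step
    splits : M ≡ before ++ (U ∷ replicate flats F ++ D ∷ after)

humpHeight : ∀ {M} → Hump M → ℕ
humpHeight P = suc (walk 0 (Hump.before P))

HM : ℕ → ℕ → Set
HM n k = Σ (List Step) λ M → IsMotzkin n M × Σ (Hump M) λ P → humpHeight P ≡ k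

-- ⋃_{1 ≤ k ≤ ⌊n/2⌋} HM_{n,k}  (disjoint, as k is determined by the hump)
HMUnion : ℕ → Set
HMUnion n = Σ ℕ λ k → 1 ≤ k × k ≤ n / 2 × HM n k

-- Standard Young tableaux (English notation), given as their list of rows

-- i-th part of a partition (0-indexed), 0 beyond its length
part : List ℕ → ℕ → ℕ
part []       _       = 0
part (x ∷ _)  zero    = x
part (_ ∷ xs) (suc i) = part xs i

shape : List (List ℕ) → List ℕ
shape = map length

-- entry-wise strict increase down a column: each cell of the lower row
-- has a cell directly above it, with a smaller entry
ColLt : List ℕ → List ℕ → Set
ColLt _        []       = ⊤
ColLt []       (_ ∷ _)  = ⊥
ColLt (x ∷ xs) (y ∷ ys) = x < y × ColLt xs ys

occ : ℕ → List ℕ → ℕ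
occ m xs = length (filter (_≟ m) xs)

IsSYT : ℕ → List (List ℕ) → Set
IsSYT n T =
  All (λ r → 1 ≤ length r) T
  × Linked _≥_ (shape T)
  × All (Linked _<_) T
  × Linked ColLt T
  × length (concat T) ≡ n
  × All (λ m → occ m (concat T) ≡ 1) (applyUpTo suc n)

-- S_k(2,1;n): SYT of a shape λ ⊢ n with λ₃ ≤ 1 and λ₁ - λ₂ = k
S21 : ℕ → ℕ → Set
S21 k n = Σ (List (List ℕ)) λ T →
  IsSYT n T × part (shape T) 2 ≤ 1 × part (shape T) 0 ≡ part (shape T) 1 + k

S21Union : ℕ → Set
S21Union n = Σ ℕ λ k → k ≤ n ∸ 2 × S21 k n

-- Cut a marked path at its hump, M = A U Fᶠ D B, with A rising from 0 to the hump height h and B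
-- falling from h back to 0. Factoring a step word into Motzkin pieces separated by its unmatched
-- steps, the marked path is encoded by f, two end pieces and h pairs of pieces. Splitting the end
-- piece of B into its arches and regrouping turns these data into a word U^(f+d+1) D v in which v
-- has exactly d unmatched down steps, so the word never drops below the axis. These ballot words,
-- whose first non-U letter is D, are the Yamanouchi words of the standard Young tableaux of shape
-- (λ₁, λ₂, 1, …, 1): the positions of U, D and F are the first row, the second row and the rest of
-- the first column, and λ₁ - λ₂ = #U - #D.

module Submission where

open import Defs
open import Data.Nat using (ℕ; zero; suc; _+_; _*_; _∸_; _≤_; _<_; _≥_; z≤n; s≤s; s≤s⁻¹; _/_; _≟_)
open import Data.Nat.Properties
open import Data.Nat.DivMod using (m*n/n≡m; /-monoˡ-≤)
open import Data.Nat.Tactic.RingSolver using (solve-∀)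
open import Data.Bool using (if_then_else_)
open import Data.Empty using (⊥; ⊥-elim)
open import Data.Unit using (⊤; tt)
open import Data.Sum using (inj₁; inj₂)
open import Data.Product using (Σ; _×_; _,_; proj₁; proj₂)
open import Data.Product.Function.NonDependent.Propositional using (_×-⇔_)
open import Data.Maybe using (Maybe; just; nothing)
open import Data.Maybe.Relation.Binary.Connected using (Connected; just; just-nothing)
import Data.List as List
open import Data.List using (List; []; _∷_; _++_; [_]; replicate; length; map; concat; filter; applyUpTo; foldl; zip; unzip)
open import Data.List.Properties
  using (length-++; length-++-≤ˡ; length-map; length-replicate; ++-assoc; ++-identityʳ; foldl-++; zip-unzip; unzip-zip;
         filter-++; filter-accept; filter-reject; filter-notAll; concat-map-[_])
open import Data.List.Membership.Propositional using (_∈_; _∉_)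
open import Data.List.Membership.Propositional.Properties using (∈-filter⁺; ∈-++⁺ˡ; ∈-++⁺ʳ; ∈-++⁻)
open import Data.List.Membership.DecPropositional _≟_ using (_∈?_)
open import Data.List.Relation.Unary.Any using (here; there)
import Data.List.Relation.Unary.Any as Any
open import Data.List.Relation.Unary.All using (All; []; _∷_)
import Data.List.Relation.Unary.All as All
import Data.List.Relation.Unary.All.Properties as Allₚ
open import Data.List.Relation.Unary.Linked using (Linked; []; [-]; _∷_; _∷′_)
import Data.List.Relation.Unary.Linked as Linked
import Data.List.Relation.Unary.Linked.Properties as Linkedₚ
open import Function using (_∘_; id)
open import Function.Bundles using (_⤖_; _↔_; _⇔_; mk↔ₛ′; mk⇔; Equivalence)
open import Function.Construct.Identity using (⇔-id)
open import Function.Properties.Inverse using (↔⇒⤖)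
open import Function.Related.Propositional using (module EquationalReasoning; equivalence; bijection)
open import Relation.Nullary using (Dec; yes; no; does; ¬?; _×-dec_)
open import Relation.Nullary.Irrelevant using (Irrelevant)
import Relation.Unary as U
open import Relation.Binary.Definitions using (DecidableEquality)
open import Relation.Binary.PropositionalEquality hiding ([_])

open Equivalence using (to; from)

×-irrelevant : {A B : Set} → Irrelevant A → Irrelevant B → Irrelevant (A × B)
×-irrelevant irrA irrB (a , b) (a′ , b′) = cong₂ _,_ (irrA a a′) (irrB b b′)

Σ-≡-irrelevant : ∀ {C : Set} {R : C → Set} → U.Irrelevant R → ∀ {c c′} {r : R c} {r′ : R c′} →
                 c ≡ c′ → (c , r) ≡ (c′ , r′)
Σ-≡-irrelevant irrR refl = cong (_ ,_) (irrR _ _)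

Σ-↔ : {A B : Set} {P : A → Set} {Q : B → Set} → U.Irrelevant P → U.Irrelevant Q →
      (f : A → B) (g : B → A) → (∀ {a} → P a → Q (f a)) → (∀ {b} → Q b → P (g b)) →
      (∀ {b} → Q b → f (g b) ≡ b) → (∀ {a} → P a → g (f a) ≡ a) →
      Σ A P ↔ Σ B Q
Σ-↔ irrP irrQ f g f-resp g-resp f∘g g∘f =
  mk↔ₛ′ (λ (a , p) → f a , f-resp p) (λ (b , q) → g b , g-resp q)
        (λ (b , q) → Σ-≡-irrelevant irrQ (f∘g q)) (λ (a , p) → Σ-≡-irrelevant irrP (g∘f p))

data Motzkin : Set where
  ε    : Motzkin
  flat : Motzkin → Motzkin
  rise : Motzkin → Motzkin → Motzkin

steps : Motzkin → List Step
steps ε          = []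
steps (flat m)   = F ∷ steps m
steps (rise a b) = U ∷ steps a ++ D ∷ steps b

size : Motzkin → ℕ
size ε          = 0
size (flat m)   = suc (size m)
size (rise a b) = suc (size a + suc (size b))

length-steps : ∀ m → length (steps m) ≡ size m
length-steps ε          = refl
length-steps (flat m)   = cong suc (length-steps m)
length-steps (rise a b) =
  cong suc (trans (length-++ (steps a)) (cong₂ (λ x y → x + suc y) (length-steps a) (length-steps b)))

infixr 5 _⊕_
_⊕_ : Motzkin → Motzkin → Motzkin
ε        ⊕ m = m
flat a   ⊕ m = flat (a ⊕ m)
rise a b ⊕ m = rise a (b ⊕ m)

⊕-identityʳ : ∀ a → a ⊕ ε ≡ a
⊕-identityʳ ε          = refl
⊕-identityʳ (flat a)   = cong flat (⊕-identityʳ a)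
⊕-identityʳ (rise a b) = cong (rise a) (⊕-identityʳ b)

⊕-assoc : ∀ a b c → (a ⊕ b) ⊕ c ≡ a ⊕ (b ⊕ c)
⊕-assoc ε          b c = refl
⊕-assoc (flat a)   b c = cong flat (⊕-assoc a b c)
⊕-assoc (rise a d) b c = cong (rise a) (⊕-assoc d b c)

steps-⊕ : ∀ a b → steps (a ⊕ b) ≡ steps a ++ steps b
steps-⊕ ε          b = refl
steps-⊕ (flat a)   b = cong (F ∷_) (steps-⊕ a b)
steps-⊕ (rise a d) b = cong (U ∷_) (begin
  steps a ++ D ∷ steps (d ⊕ b)          ≡⟨ cong (λ w → steps a ++ D ∷ w) (steps-⊕ d b) ⟩
  steps a ++ (D ∷ steps d) ++ steps b   ≡⟨ ++-assoc (steps a) (D ∷ steps d) (steps b) ⟨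
  (steps a ++ D ∷ steps d) ++ steps b   ∎)
  where open ≡-Reasoning

-- unfactor (factors [Nₖ, …, N₁] t [Pₘ, …, P₁]) = N₁ D ⋯ Nₖ D P₁ U ⋯ Pₘ U t, where the displayed
-- D and U are exactly the unmatched steps; factor recovers the pieces by reading a word left to right.
record Factorization : Set where
  constructor factors
  field
    downs : List Motzkin
    final : Motzkin
    ups   : List Motzkin
open Factorization

withDowns : List Motzkin → List Step → List Step
withDowns []       w = w
withDowns (N ∷ ds) w = withDowns ds (steps N ++ D ∷ w)

withUps : List Motzkin → Motzkin → List Step
withUps []       t = steps t
withUps (p ∷ us) t = withUps us p ++ U ∷ steps t

unfactor : Factorization → List Step
unfactor (factors ds t us) = withDowns ds (withUps us t)

push : Factorization → Step → Factorization
push (factors ds t us)       F = factors ds (t ⊕ flat ε) us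
push (factors ds t us)       U = factors ds ε (t ∷ us)
push (factors ds t (p ∷ us)) D = factors ds (p ⊕ rise t ε) us
push (factors ds t [])       D = factors (t ∷ ds) ε []

factor : List Step → Factorization
factor = foldl push (factors [] ε [])

withDowns-++ : ∀ ds w z → withDowns ds (w ++ z) ≡ withDowns ds w ++ z
withDowns-++ []       w z = refl
withDowns-++ (N ∷ ds) w z =
  trans (cong (withDowns ds) (sym (++-assoc (steps N) (D ∷ w) z))) (withDowns-++ ds (steps N ++ D ∷ w) z)

withUps-⊕ : ∀ us t m → withUps us (t ⊕ m) ≡ withUps us t ++ steps m
withUps-⊕ []       t m = steps-⊕ t m
withUps-⊕ (p ∷ us) t m =
  trans (cong (λ w → withUps us p ++ U ∷ w) (steps-⊕ t m)) (sym (++-assoc (withUps us p) (U ∷ steps t) (steps m)))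

unfactor-push : ∀ φ x → unfactor (push φ x) ≡ unfactor φ ++ [ x ]
unfactor-push (factors ds t us)       F =
  trans (cong (withDowns ds) (withUps-⊕ us t (flat ε))) (withDowns-++ ds (withUps us t) [ F ])
unfactor-push (factors ds t us)       U = withDowns-++ ds (withUps us t) [ U ]
unfactor-push (factors ds t (p ∷ us)) D =
  trans (cong (withDowns ds) (trans (withUps-⊕ us p (rise t ε)) (sym (++-assoc (withUps us p) (U ∷ steps t) [ D ]))))
        (withDowns-++ ds (withUps us p ++ U ∷ steps t) [ D ])
unfactor-push (factors ds t [])       D = withDowns-++ ds (steps t) [ D ]

unfactor-foldl-push : ∀ φ s → unfactor (foldl push φ s) ≡ unfactor φ ++ s
unfactor-foldl-push φ []      = sym (++-identityʳ (unfactor φ))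
unfactor-foldl-push φ (x ∷ s) = begin
  unfactor (foldl push (push φ x) s)  ≡⟨ unfactor-foldl-push (push φ x) s ⟩
  unfactor (push φ x) ++ s            ≡⟨ cong (_++ s) (unfactor-push φ x) ⟩
  (unfactor φ ++ [ x ]) ++ s          ≡⟨ ++-assoc (unfactor φ) [ x ] s ⟩
  unfactor φ ++ x ∷ s                 ∎
  where open ≡-Reasoning

unfactor-factor : ∀ s → unfactor (factor s) ≡ s
unfactor-factor = unfactor-foldl-push (factors [] ε [])

foldl-push-steps : ∀ ds t us m → foldl push (factors ds t us) (steps m) ≡ factors ds (t ⊕ m) us
foldl-push-steps ds t us ε          = cong (λ z → factors ds z us) (sym (⊕-identityʳ t))
foldl-push-steps ds t us (flat m)   =
  trans (foldl-push-steps ds (t ⊕ flat ε) us m) (cong (λ z → factors ds z us) (⊕-assoc t (flat ε) m))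
foldl-push-steps ds t us (rise a b) = begin
  foldl push (factors ds ε (t ∷ us)) (steps a ++ D ∷ steps b)
    ≡⟨ foldl-++ push (factors ds ε (t ∷ us)) (steps a) (D ∷ steps b) ⟩
  foldl push (foldl push (factors ds ε (t ∷ us)) (steps a)) (D ∷ steps b)
    ≡⟨ cong (λ φ → foldl push φ (D ∷ steps b)) (foldl-push-steps ds ε (t ∷ us) a) ⟩
  foldl push (factors ds (t ⊕ rise a ε) us) (steps b)
    ≡⟨ foldl-push-steps ds (t ⊕ rise a ε) us b ⟩
  factors ds ((t ⊕ rise a ε) ⊕ b) us
    ≡⟨ cong (λ z → factors ds z us) (⊕-assoc t (rise a ε) b) ⟩
  factors ds (t ⊕ rise a b) us ∎
  where open ≡-Reasoning

foldl-push-withDowns : ∀ ds w ds₀ →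
  foldl push (factors ds₀ ε []) (withDowns ds w) ≡ foldl push (factors (ds ++ ds₀) ε []) w
foldl-push-withDowns []       w ds₀ = refl
foldl-push-withDowns (N ∷ ds) w ds₀ =
  trans (foldl-push-withDowns ds (steps N ++ D ∷ w) ds₀)
  (trans (foldl-++ push (factors (ds ++ ds₀) ε []) (steps N) (D ∷ w))
         (cong (λ φ → foldl push φ (D ∷ w)) (foldl-push-steps (ds ++ ds₀) ε [] N)))

foldl-push-withUps : ∀ ds us t → foldl push (factors ds ε []) (withUps us t) ≡ factors ds t us
foldl-push-withUps ds []       t = foldl-push-steps ds ε [] t
foldl-push-withUps ds (p ∷ us) t =
  trans (foldl-++ push (factors ds ε []) (withUps us p) (U ∷ steps t))
  (trans (cong (λ φ → foldl push φ (U ∷ steps t)) (foldl-push-withUps ds us p))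
         (foldl-push-steps ds ε (p ∷ us) t))

factor-unfactor : ∀ φ → factor (unfactor φ) ≡ φ
factor-unfactor (factors ds t us) =
  trans (foldl-push-withDowns ds (withUps us t) [])
  (trans (cong (λ ds′ → foldl push (factors ds′ ε []) (withUps us t)) (++-identityʳ ds))
         (foldl-push-withUps ds us t))

length≡0⇒[] : ∀ {A : Set} {xs : List A} → length xs ≡ 0 → xs ≡ []
length≡0⇒[] {xs = []} _ = refl

Nonneg : ℕ → List Step → Set
Nonneg h       []      = ⊤
Nonneg h       (U ∷ s) = Nonneg (suc h) s
Nonneg zero    (D ∷ s) = ⊥
Nonneg (suc h) (D ∷ s) = Nonneg h s
Nonneg h       (F ∷ s) = Nonneg h s

Nonneg-irrelevant : ∀ h s → Irrelevant (Nonneg h s)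
Nonneg-irrelevant h       []      _ _ = refl
Nonneg-irrelevant h       (U ∷ s) = Nonneg-irrelevant (suc h) s
Nonneg-irrelevant zero    (D ∷ s) ()
Nonneg-irrelevant (suc h) (D ∷ s) = Nonneg-irrelevant h s
Nonneg-irrelevant h       (F ∷ s) = Nonneg-irrelevant h s

ValidFrom-irrelevant : ∀ h s → Irrelevant (ValidFrom h s)
ValidFrom-irrelevant h       []      = ≡-irrelevant
ValidFrom-irrelevant h       (U ∷ s) = ValidFrom-irrelevant (suc h) s
ValidFrom-irrelevant zero    (D ∷ s) ()
ValidFrom-irrelevant (suc h) (D ∷ s) = ValidFrom-irrelevant h s
ValidFrom-irrelevant h       (F ∷ s) = ValidFrom-irrelevant h s

walk-++ : ∀ h s t → walk h (s ++ t) ≡ walk (walk h s) t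
walk-++ h []      t = refl
walk-++ h (U ∷ s) t = walk-++ (suc h) s t
walk-++ h (D ∷ s) t = walk-++ (h ∸ 1) s t
walk-++ h (F ∷ s) t = walk-++ h s t

Nonneg-++ : ∀ h s t → Nonneg h (s ++ t) ⇔ (Nonneg h s × Nonneg (walk h s) t)
Nonneg-++ h       []      t = mk⇔ (tt ,_) proj₂
Nonneg-++ h       (U ∷ s) t = Nonneg-++ (suc h) s t
Nonneg-++ zero    (D ∷ s) t = mk⇔ (λ ()) (λ ())
Nonneg-++ (suc h) (D ∷ s) t = Nonneg-++ h s t
Nonneg-++ h       (F ∷ s) t = Nonneg-++ h s t

ValidFrom-++ : ∀ h s t → ValidFrom h (s ++ t) ⇔ (Nonneg h s × ValidFrom (walk h s) t)
ValidFrom-++ h       []      t = mk⇔ (tt ,_) proj₂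
ValidFrom-++ h       (U ∷ s) t = ValidFrom-++ (suc h) s t
ValidFrom-++ zero    (D ∷ s) t = mk⇔ (λ ()) (λ ())
ValidFrom-++ (suc h) (D ∷ s) t = ValidFrom-++ h s t
ValidFrom-++ h       (F ∷ s) t = ValidFrom-++ h s t

ValidFrom⇔Nonneg×walk≡0 : ∀ h s → ValidFrom h s ⇔ (Nonneg h s × walk h s ≡ 0)
ValidFrom⇔Nonneg×walk≡0 h       []      = mk⇔ (tt ,_) proj₂
ValidFrom⇔Nonneg×walk≡0 h       (U ∷ s) = ValidFrom⇔Nonneg×walk≡0 (suc h) s
ValidFrom⇔Nonneg×walk≡0 zero    (D ∷ s) = mk⇔ (λ ()) (λ ())
ValidFrom⇔Nonneg×walk≡0 (suc h) (D ∷ s) = ValidFrom⇔Nonneg×walk≡0 h s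
ValidFrom⇔Nonneg×walk≡0 h       (F ∷ s) = ValidFrom⇔Nonneg×walk≡0 h s

walk≤ : ∀ h s → walk h s ≤ h + length s
walk≤ h []      = m≤m+n h 0
walk≤ h (U ∷ s) = ≤-trans (walk≤ (suc h) s) (≤-reflexive (sym (+-suc h (length s))))
walk≤ h (D ∷ s) = ≤-trans (walk≤ (h ∸ 1) s) (+-mono-≤ (m∸n≤m h 1) (n≤1+n (length s)))
walk≤ h (F ∷ s) = ≤-trans (walk≤ h s) (+-monoʳ-≤ h (n≤1+n (length s)))

ValidFrom⇒≤length : ∀ h s → ValidFrom h s → h ≤ length s
ValidFrom⇒≤length h       []      refl = z≤n
ValidFrom⇒≤length h       (U ∷ s) v    = ≤-trans (n≤1+n h) (m≤n⇒m≤1+n (ValidFrom⇒≤length (suc h) s v))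
ValidFrom⇒≤length zero    (D ∷ s) ()
ValidFrom⇒≤length (suc h) (D ∷ s) v    = s≤s (ValidFrom⇒≤length h s v)
ValidFrom⇒≤length h       (F ∷ s) v    = m≤n⇒m≤1+n (ValidFrom⇒≤length h s v)

walk-steps : ∀ h m → walk h (steps m) ≡ h
walk-steps h ε          = refl
walk-steps h (flat m)   = walk-steps h m
walk-steps h (rise a b) = begin
  walk h (steps (rise a b))              ≡⟨ walk-++ (suc h) (steps a) (D ∷ steps b) ⟩
  walk (walk (suc h) (steps a) ∸ 1) (steps b) ≡⟨ cong (λ z → walk (z ∸ 1) (steps b)) (walk-steps (suc h) a) ⟩
  walk h (steps b)                       ≡⟨ walk-steps h b ⟩
  h                                      ∎
  where open ≡-Reasoning

Nonneg-steps : ∀ h m → Nonneg h (steps m)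
Nonneg-steps h ε          = tt
Nonneg-steps h (flat m)   = Nonneg-steps h m
Nonneg-steps h (rise a b) = from (Nonneg-++ (suc h) (steps a) (D ∷ steps b))
  (Nonneg-steps (suc h) a , subst (λ z → Nonneg z (D ∷ steps b)) (sym (walk-steps (suc h) a)) (Nonneg-steps h b))

Nonneg-steps-++ : ∀ h m w → Nonneg h (steps m ++ w) ⇔ Nonneg h w
Nonneg-steps-++ h m w = mk⇔
  (λ p → subst (λ z → Nonneg z w) (walk-steps h m) (proj₂ (to (Nonneg-++ h (steps m) w) p)))
  (λ p → from (Nonneg-++ h (steps m) w) (Nonneg-steps h m , subst (λ z → Nonneg z w) (sym (walk-steps h m)) p))

walk-withDowns : ∀ h ds w → walk h (withDowns ds w) ≡ walk (h ∸ length ds) w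
walk-withDowns h []       w = refl
walk-withDowns h (N ∷ ds) w = begin
  walk h (withDowns ds (steps N ++ D ∷ w))  ≡⟨ walk-withDowns h ds (steps N ++ D ∷ w) ⟩
  walk h′ (steps N ++ D ∷ w)                ≡⟨ walk-++ h′ (steps N) (D ∷ w) ⟩
  walk (walk h′ (steps N) ∸ 1) w            ≡⟨ cong (λ z → walk (z ∸ 1) w) (walk-steps h′ N) ⟩
  walk (h ∸ length ds ∸ 1) w                ≡⟨ cong (λ z → walk z w) (∸-+-assoc h (length ds) 1) ⟩
  walk (h ∸ (length ds + 1)) w              ≡⟨ cong (λ z → walk (h ∸ z) w) (+-comm (length ds) 1) ⟩
  walk (h ∸ length (N ∷ ds)) w              ∎
  where
  open ≡-Reasoning
  h′ = h ∸ length ds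

walk-withUps : ∀ h us t → walk h (withUps us t) ≡ h + length us
walk-withUps h []       t = trans (walk-steps h t) (sym (+-identityʳ h))
walk-withUps h (p ∷ us) t = begin
  walk h (withUps us p ++ U ∷ steps t)           ≡⟨ walk-++ h (withUps us p) (U ∷ steps t) ⟩
  walk (suc (walk h (withUps us p))) (steps t)   ≡⟨ walk-steps _ t ⟩
  suc (walk h (withUps us p))                    ≡⟨ cong suc (walk-withUps h us p) ⟩
  suc (h + length us)                            ≡⟨ +-suc h (length us) ⟨
  h + length (p ∷ us)                            ∎
  where open ≡-Reasoning

Nonneg-withUps : ∀ h us t → Nonneg h (withUps us t)
Nonneg-withUps h []       t = Nonneg-steps h t
Nonneg-withUps h (p ∷ us) t =
  from (Nonneg-++ h (withUps us p) (U ∷ steps t)) (Nonneg-withUps h us p , Nonneg-steps _ t)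

Nonneg-∸-D∷ : ∀ a h w → (a ≤ h × Nonneg (h ∸ a) (D ∷ w)) ⇔ (suc a ≤ h × Nonneg (h ∸ suc a) w)
Nonneg-∸-D∷ zero    zero    w = mk⇔ (λ ()) (λ ())
Nonneg-∸-D∷ zero    (suc h) w = mk⇔ (λ (_ , p) → s≤s z≤n , p) (λ (_ , p) → z≤n , p)
Nonneg-∸-D∷ (suc a) zero    w = mk⇔ (λ ()) (λ ())
Nonneg-∸-D∷ (suc a) (suc h) w = mk⇔
  (λ (a≤h , p) → let (a<h , q) = to (Nonneg-∸-D∷ a h w) (s≤s⁻¹ a≤h , p) in s≤s a<h , q)
  (λ (a<h , q) → let (a≤h , p) = from (Nonneg-∸-D∷ a h w) (s≤s⁻¹ a<h , q) in s≤s a≤h , p)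

Nonneg-withDowns : ∀ h ds w → Nonneg h (withDowns ds w) ⇔ (length ds ≤ h × Nonneg (h ∸ length ds) w)
Nonneg-withDowns h []       w = mk⇔ (z≤n ,_) proj₂
Nonneg-withDowns h (N ∷ ds) w = begin
  Nonneg h (withDowns ds (steps N ++ D ∷ w))                  ∼⟨ Nonneg-withDowns h ds _ ⟩
  (length ds ≤ h × Nonneg (h ∸ length ds) (steps N ++ D ∷ w))  ∼⟨ ⇔-id _ ×-⇔ Nonneg-steps-++ _ N _ ⟩
  (length ds ≤ h × Nonneg (h ∸ length ds) (D ∷ w))            ∼⟨ Nonneg-∸-D∷ (length ds) h w ⟩
  (length (N ∷ ds) ≤ h × Nonneg (h ∸ length (N ∷ ds)) w)       ∎
  where open EquationalReasoning {k = equivalence}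

Nonneg-unfactor : ∀ h φ → Nonneg h (unfactor φ) ⇔ length (downs φ) ≤ h
Nonneg-unfactor h (factors ds t us) = mk⇔
  (λ p → proj₁ (to (Nonneg-withDowns h ds (withUps us t)) p))
  (λ le → from (Nonneg-withDowns h ds (withUps us t)) (le , Nonneg-withUps _ us t))

walk-unfactor : ∀ h φ → walk h (unfactor φ) ≡ h ∸ length (downs φ) + length (ups φ)
walk-unfactor h (factors ds t us) = trans (walk-withDowns h ds (withUps us t)) (walk-withUps (h ∸ length ds) us t)

ValidFrom-unfactor : ∀ h φ → ValidFrom h (unfactor φ) ⇔ (ups φ ≡ [] × length (downs φ) ≡ h)
ValidFrom-unfactor h φ@(factors ds t us) = mk⇔ valid⇒ ⇒valid
  where
  valid⇒ : ValidFrom h (unfactor φ) → us ≡ [] × length ds ≡ h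
  valid⇒ v =
    let (nonneg , ends-at-0) = to (ValidFrom⇔Nonneg×walk≡0 h (unfactor φ)) v
        sum≡0 = trans (sym (walk-unfactor h φ)) ends-at-0
    in  length≡0⇒[] (m+n≡0⇒n≡0 (h ∸ length ds) sum≡0) ,
        ≤-antisym (to (Nonneg-unfactor h φ) nonneg) (m∸n≡0⇒m≤n (m+n≡0⇒m≡0 (h ∸ length ds) sum≡0))
  ⇒valid : us ≡ [] × length ds ≡ h → ValidFrom h (unfactor φ)
  ⇒valid (refl , refl) = from (ValidFrom⇔Nonneg×walk≡0 h (unfactor φ))
    (from (Nonneg-unfactor h φ) ≤-refl , trans (walk-unfactor h φ) (trans (+-identityʳ _) (n∸n≡0 h)))

humpWord : List Step → ℕ → List Step → List Step
humpWord A f B = A ++ U ∷ replicate f F ++ D ∷ B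

length-humpWord : ∀ A f B → length (humpWord A f B) ≡ length A + suc (f + suc (length B))
length-humpWord A f B = trans (length-++ A)
  (cong (λ z → length A + suc z) (trans (length-++ (replicate f F)) (cong (_+ suc (length B)) (length-replicate f))))

ValidFrom-flats : ∀ h f s → ValidFrom h (replicate f F ++ s) ≡ ValidFrom h s
ValidFrom-flats h zero    s = refl
ValidFrom-flats h (suc f) s = ValidFrom-flats h f s

ValidFrom-humpWord : ∀ A f B → ValidFrom 0 (humpWord A f B) ⇔ (Nonneg 0 A × ValidFrom (walk 0 A) B)
ValidFrom-humpWord A f B = begin
  ValidFrom 0 (humpWord A f B)
    ∼⟨ ValidFrom-++ 0 A _ ⟩
  (Nonneg 0 A × ValidFrom (suc (walk 0 A)) (replicate f F ++ D ∷ B))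
    ≡⟨ cong (Nonneg 0 A ×_) (ValidFrom-flats _ f (D ∷ B)) ⟩
  (Nonneg 0 A × ValidFrom (walk 0 A) B)
    ∎
  where open EquationalReasoning {k = equivalence}

HumpedPaths : ℕ → Set
HumpedPaths n = Σ (List Step × ℕ × List Step) λ (A , f , B) →
  ValidFrom 0 (humpWord A f B) × length (humpWord A f B) ≡ n

double-humpHeight≤length : ∀ A f B → ValidFrom 0 (humpWord A f B) → 2 * suc (walk 0 A) ≤ length (humpWord A f B)
double-humpHeight≤length A f B valid = begin
  2 * suc h                          ≡⟨ double h ⟩
  h + suc (suc h)                    ≤⟨ +-mono-≤ (walk≤ 0 A) (s≤s (m≤n⇒m≤o+n f (s≤s h≤B))) ⟩
  length A + suc (f + suc (length B)) ≡⟨ length-humpWord A f B ⟨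
  length (humpWord A f B)            ∎
  where
  open ≤-Reasoning
  h = walk 0 A
  h≤B : h ≤ length B
  h≤B = ValidFrom⇒≤length h B (proj₂ (to (ValidFrom-humpWord A f B) valid))
  double : ∀ h → 2 * suc h ≡ h + suc (suc h)
  double = solve-∀

double≤⇒≤half : ∀ k n → 2 * k ≤ n → k ≤ n / 2
double≤⇒≤half k n 2k≤n = begin
  k          ≡⟨ m*n/n≡m k 2 ⟨
  k * 2 / 2  ≤⟨ /-monoˡ-≤ 2 (≤-trans (≤-reflexive (*-comm k 2)) 2k≤n) ⟩
  n / 2      ∎
  where open ≤-Reasoning

HMUnion↔HumpedPaths : ∀ n → HMUnion n ↔ HumpedPaths n
HMUnion↔HumpedPaths n = mk↔ₛ′ forget-height with-height (λ _ → refl) with-height∘forget-height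
  where
  forget-height : HMUnion n → HumpedPaths n
  forget-height (_ , _ , _ , M , (len , valid) , hump A f B M≡ , _) =
    (A , f , B) , subst (ValidFrom 0) M≡ valid , trans (cong length (sym M≡)) len
  with-height : HumpedPaths n → HMUnion n
  with-height ((A , f , B) , valid , len) =
    suc (walk 0 A) , s≤s z≤n ,
    double≤⇒≤half _ n (subst (2 * suc (walk 0 A) ≤_) len (double-humpHeight≤length A f B valid)) ,
    humpWord A f B , (len , valid) , hump A f B refl , refl
  with-height∘forget-height : ∀ x → with-height (forget-height x) ≡ x
  with-height∘forget-height (_ , 1≤k , k≤n/2 , _ , _ , hump A f B refl , refl) =
    cong₂ (λ p q → suc (walk 0 A) , p , q , _) (≤-irrelevant _ 1≤k) (≤-irrelevant _ k≤n/2)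

weight : List Motzkin → ℕ
weight []       = 0
weight (m ∷ ms) = suc (size m) + weight ms

length-withDowns : ∀ ds w → length (withDowns ds w) ≡ weight ds + length w
length-withDowns []       w = refl
length-withDowns (N ∷ ds) w = begin
  length (withDowns ds (steps N ++ D ∷ w))        ≡⟨ length-withDowns ds (steps N ++ D ∷ w) ⟩
  weight ds + length (steps N ++ D ∷ w)          ≡⟨ cong (weight ds +_) (length-++ (steps N)) ⟩
  weight ds + (length (steps N) + suc (length w)) ≡⟨ cong (λ z → weight ds + (z + suc (length w))) (length-steps N) ⟩
  weight ds + (size N + suc (length w))          ≡⟨ rearrange (weight ds) (size N) (length w) ⟩
  weight (N ∷ ds) + length w                     ∎
  where
  open ≡-Reasoning
  rearrange : ∀ a b c → a + (b + suc c) ≡ suc b + a + c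
  rearrange = solve-∀

length-withUps : ∀ us t → length (withUps us t) ≡ weight us + size t
length-withUps []       t = length-steps t
length-withUps (p ∷ us) t = begin
  length (withUps us p ++ U ∷ steps t)
    ≡⟨ length-++ (withUps us p) ⟩
  length (withUps us p) + suc (length (steps t))
    ≡⟨ cong₂ (λ x y → x + suc y) (length-withUps us p) (length-steps t) ⟩
  weight us + size p + suc (size t)
    ≡⟨ rearrange (weight us) (size p) (size t) ⟩
  weight (p ∷ us) + size t
    ∎
  where
  open ≡-Reasoning
  rearrange : ∀ a b c → a + b + suc c ≡ suc b + a + c
  rearrange = solve-∀

length-unfactor : ∀ φ → length (unfactor φ) ≡ weight (downs φ) + (weight (ups φ) + size (final φ))
length-unfactor (factors ds t us) = trans (length-withDowns ds (withUps us t)) (cong (weight ds +_) (length-withUps us t))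

-- Encodes the valid hump word P₁ U ⋯ Pₕ U left U Fᶠ D X₁ D ⋯ Xₕ D right (all pieces Motzkin)
-- with pairs = [(Pₕ , Xₕ), …, (P₁ , X₁)].
record HumpPieces : Set where
  constructor pieces
  field
    flatCount : ℕ
    left      : Motzkin
    pairs     : List (Motzkin × Motzkin)
    right     : Motzkin
open HumpPieces

pairWeight : List (Motzkin × Motzkin) → ℕ
pairWeight []             = 0
pairWeight ((a , b) ∷ ps) = suc (size a) + suc (size b) + pairWeight ps

humpSize : HumpPieces → ℕ
humpSize (pieces f l ps r) = suc (suc (f + size l + size r + pairWeight ps))

length-unzip : ∀ {A B : Set} (ps : List (A × B)) → length (proj₂ (unzip ps)) ≡ length (proj₁ (unzip ps))
length-unzip []       = refl
length-unzip (_ ∷ ps) = cong suc (length-unzip ps)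

weight-unzip : ∀ ps → weight (proj₁ (unzip ps)) + weight (proj₂ (unzip ps)) ≡ pairWeight ps
weight-unzip []             = refl
weight-unzip ((a , b) ∷ ps) = trans (rearrange (suc (size a)) (suc (size b)) (weight (proj₁ (unzip ps))) _)
                                    (cong (suc (size a) + suc (size b) +_) (weight-unzip ps))
  where
  rearrange : ∀ a b c d → a + c + (b + d) ≡ a + b + (c + d)
  rearrange = solve-∀

ValidFrom-humpWord-unfactor : ∀ φ f ψ → ValidFrom 0 (humpWord (unfactor φ) f (unfactor ψ)) ⇔
  (downs φ ≡ [] × ups ψ ≡ [] × length (downs ψ) ≡ length (ups φ))
ValidFrom-humpWord-unfactor φ f ψ = mk⇔
  (λ valid → let (nonneg , validB) = to (ValidFrom-humpWord A f B) valid
                 (ups≡[] , len≡)   = to (ValidFrom-unfactor _ ψ) validB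
             in  length≡0⇒[] (n≤0⇒n≡0 (to (Nonneg-unfactor 0 φ) nonneg)) , ups≡[] , trans len≡ height≡)
  (λ (downs≡[] , ups≡[] , len≡) → from (ValidFrom-humpWord A f B)
     (from (Nonneg-unfactor 0 φ) (≤-reflexive (cong length downs≡[])) ,
      from (ValidFrom-unfactor _ ψ) (ups≡[] , trans len≡ (sym height≡))))
  where
  A = unfactor φ
  B = unfactor ψ
  height≡ : walk 0 A ≡ length (ups φ)
  height≡ = trans (walk-unfactor 0 φ) (cong (_+ length (ups φ)) (0∸n≡0 (length (downs φ))))

leftPath : HumpPieces → List Step
leftPath p = unfactor (factors [] (left p) (proj₁ (unzip (pairs p))))

rightPath : HumpPieces → List Step
rightPath p = unfactor (factors (proj₂ (unzip (pairs p))) (right p) [])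

splitHump : List Step × ℕ × List Step → HumpPieces
splitHump (A , f , B) = pieces f (final (factor A)) (zip (ups (factor A)) (downs (factor B))) (final (factor B))

joinHump : HumpPieces → List Step × ℕ × List Step
joinHump p = leftPath p , flatCount p , rightPath p

ValidFrom-humpWord-factor : ∀ A f B → ValidFrom 0 (humpWord A f B) →
  downs (factor A) ≡ [] × ups (factor B) ≡ [] × length (downs (factor B)) ≡ length (ups (factor A))
ValidFrom-humpWord-factor A f B valid = to (ValidFrom-humpWord-unfactor (factor A) f (factor B))
  (subst₂ (λ A′ B′ → ValidFrom 0 (humpWord A′ f B′)) (sym (unfactor-factor A)) (sym (unfactor-factor B)) valid)

joinHump∘splitHump : ∀ A f B → ValidFrom 0 (humpWord A f B) → joinHump (splitHump (A , f , B)) ≡ (A , f , B)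
joinHump∘splitHump A f B valid =
  cong₂ (λ A′ B′ → A′ , f , B′) (trans left≡ (unfactor-factor A)) (trans right≡ (unfactor-factor B))
  where
  φ = factor A
  ψ = factor B
  conditions = ValidFrom-humpWord-factor A f B valid
  unzip≡ : unzip (zip (ups φ) (downs ψ)) ≡ (ups φ , downs ψ)
  unzip≡ = unzip-zip (ups φ) (downs ψ) (sym (proj₂ (proj₂ conditions)))
  left≡ : leftPath (splitHump (A , f , B)) ≡ unfactor φ
  left≡ = cong₂ (λ ds us → unfactor (factors ds (final φ) us)) (sym (proj₁ conditions)) (cong proj₁ unzip≡)
  right≡ : rightPath (splitHump (A , f , B)) ≡ unfactor ψ
  right≡ = cong₂ (λ ds us → unfactor (factors ds (final ψ) us))
                 (cong proj₂ unzip≡) (sym (proj₁ (proj₂ conditions)))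

splitHump∘joinHump : ∀ p → splitHump (joinHump p) ≡ p
splitHump∘joinHump (pieces f l ps r)
  rewrite factor-unfactor (factors [] l (proj₁ (unzip ps))) | factor-unfactor (factors (proj₂ (unzip ps)) r [])
  = cong (λ ps′ → pieces f l ps′ r) (zip-unzip ps)

ValidFrom-joinHump : ∀ p → ValidFrom 0 (humpWord (leftPath p) (flatCount p) (rightPath p))
ValidFrom-joinHump (pieces f l ps r) =
  from (ValidFrom-humpWord-unfactor (factors [] l (proj₁ (unzip ps))) f (factors (proj₂ (unzip ps)) r []))
       (refl , refl , length-unzip ps)

length-joinHump : ∀ p → length (humpWord (leftPath p) (flatCount p) (rightPath p)) ≡ humpSize p
length-joinHump (pieces f l ps r) = begin
  length (humpWord A f B)
    ≡⟨ length-humpWord A f B ⟩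
  length A + suc (f + suc (length B))
    ≡⟨ cong₂ (λ x y → x + suc (f + suc y)) (length-unfactor (factors [] l us)) (length-unfactor (factors ds r [])) ⟩
  (weight us + size l) + suc (f + suc (weight ds + size r))
    ≡⟨ rearrange (weight us) (size l) f (weight ds) (size r) ⟩
  suc (suc (f + size l + size r + (weight us + weight ds)))
    ≡⟨ cong (λ z → suc (suc (f + size l + size r + z))) (weight-unzip ps) ⟩
  humpSize (pieces f l ps r)
    ∎
  where
  open ≡-Reasoning
  us = proj₁ (unzip ps)
  ds = proj₂ (unzip ps)
  A = unfactor (factors [] l us)
  B = unfactor (factors ds r [])
  rearrange : ∀ a b c d e → a + b + suc (c + suc (d + e)) ≡ suc (suc (c + b + e + (a + d)))
  rearrange = solve-∀

HumpPiecesOfSize : ℕ → Set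
HumpPiecesOfSize n = Σ HumpPieces λ p → humpSize p ≡ n

HumpedPaths↔HumpPiecesOfSize : ∀ n → HumpedPaths n ↔ HumpPiecesOfSize n
HumpedPaths↔HumpPiecesOfSize n = Σ-↔
  (λ {(A , f , B)} → ×-irrelevant (ValidFrom-irrelevant 0 (humpWord A f B)) ≡-irrelevant) ≡-irrelevant
  splitHump joinHump
  (λ {(A , f , B)} (valid , len) →
     trans (sym (length-joinHump (splitHump (A , f , B))))
           (trans (cong (λ (A′ , f′ , B′) → length (humpWord A′ f′ B′)) (joinHump∘splitHump A f B valid)) len))
  (λ {p} size≡ → ValidFrom-joinHump p , trans (length-joinHump p) size≡)
  (λ {p} _ → splitHump∘joinHump p)
  (λ {(A , f , B)} (valid , _) → joinHump∘splitHump A f B valid)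

arches : Motzkin → List Motzkin × Maybe Motzkin
arches ε          = [] , nothing
arches (flat x)   = [] , just x
arches (rise N m) = let (ns , lo) = arches m in N ∷ ns , lo

unarches : List Motzkin → Maybe Motzkin → Motzkin
unarches []       nothing  = ε
unarches []       (just x) = flat x
unarches (N ∷ ns) lo       = rise N (unarches ns lo)

unarches-arches : ∀ m → unarches (proj₁ (arches m)) (proj₂ (arches m)) ≡ m
unarches-arches ε          = refl
unarches-arches (flat x)   = refl
unarches-arches (rise N m) = cong (rise N) (unarches-arches m)

arches-unarches : ∀ ns lo → arches (unarches ns lo) ≡ (ns , lo)
arches-unarches []       nothing  = refl
arches-unarches []       (just x) = refl
arches-unarches (N ∷ ns) lo       = cong (λ (ns′ , lo′) → N ∷ ns′ , lo′) (arches-unarches ns lo)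

maybeWeight : Maybe Motzkin → ℕ
maybeWeight nothing  = 0
maybeWeight (just x) = suc (size x)

size-unarches : ∀ ns lo → size (unarches ns lo) ≡ weight ns + length ns + maybeWeight lo
size-unarches []       nothing  = refl
size-unarches []       (just x) = refl
size-unarches (N ∷ ns) lo       = trans (cong (λ z → suc (size N + suc z)) (size-unarches ns lo))
                                        (rearrange (size N) (weight ns) (length ns) (maybeWeight lo))
  where
  rearrange : ∀ a b c d → suc (a + suc (b + c + d)) ≡ suc a + b + suc c + d
  rearrange = solve-∀

pairUp : {A : Set} → List A → List (A × A) × Maybe A
pairUp []           = [] , nothing
pairUp (x ∷ [])     = [] , just x
pairUp (x ∷ y ∷ zs) = let (ps , lo) = pairUp zs in (x , y) ∷ ps , lo

unpair : {A : Set} → List (A × A) → Maybe A → List A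
unpair []             nothing  = []
unpair []             (just x) = [ x ]
unpair ((x , y) ∷ ps) lo       = x ∷ y ∷ unpair ps lo

unpair-pairUp : {A : Set} (xs : List A) → unpair (proj₁ (pairUp xs)) (proj₂ (pairUp xs)) ≡ xs
unpair-pairUp []           = refl
unpair-pairUp (x ∷ [])     = refl
unpair-pairUp (x ∷ y ∷ zs) = cong (λ zs′ → x ∷ y ∷ zs′) (unpair-pairUp zs)

pairUp-unpair : {A : Set} (ps : List (A × A)) (lo : Maybe A) → pairUp (unpair ps lo) ≡ (ps , lo)
pairUp-unpair []             nothing  = refl
pairUp-unpair []             (just x) = refl
pairUp-unpair ((x , y) ∷ ps) lo       = cong (λ (ps′ , lo′) → (x , y) ∷ ps′ , lo′) (pairUp-unpair ps lo)

weight-unpair : ∀ ps lo → weight (unpair ps lo) ≡ pairWeight ps + maybeWeight lo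
weight-unpair []             nothing  = refl
weight-unpair []             (just x) = +-identityʳ (suc (size x))
weight-unpair ((a , b) ∷ ps) lo       =
  trans (cong (λ z → suc (size a) + (suc (size b) + z)) (weight-unpair ps lo))
        (rearrange (suc (size a)) (suc (size b)) (pairWeight ps) (maybeWeight lo))
  where
  rearrange : ∀ a b c d → a + (b + (c + d)) ≡ a + b + c + d
  rearrange = solve-∀

ballotSize : ℕ × Factorization → ℕ
ballotSize (ℓ , φ) = suc (suc (ℓ + length (downs φ) + length (unfactor φ)))

-- The last piece r = U N₁ D ⋯ U Nₖ D [F x] of the right part supplies the unmatched downs N₁, …, Nₖ;
-- the pairs, followed by the optional x, supply the unmatched ups.
regroup : HumpPieces → ℕ × Factorization
regroup (pieces f l ps r) = let (ns , lo) = arches r in f , factors ns l (unpair ps lo)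

ungroup : ℕ × Factorization → HumpPieces
ungroup (ℓ , factors ns t us) = let (ps , lo) = pairUp us in pieces ℓ t ps (unarches ns lo)

regroup∘ungroup : ∀ x → regroup (ungroup x) ≡ x
regroup∘ungroup (ℓ , factors ns t us)
  rewrite arches-unarches ns (proj₂ (pairUp us)) | unpair-pairUp us = refl

ungroup∘regroup : ∀ p → ungroup (regroup p) ≡ p
ungroup∘regroup (pieces f l ps r)
  rewrite pairUp-unpair ps (proj₂ (arches r)) | unarches-arches r = refl

ballotSize-regroup : ∀ p → ballotSize (regroup p) ≡ humpSize p
ballotSize-regroup (pieces f l ps r) = begin
  suc (suc (f + length ns + length (unfactor (factors ns l us))))
    ≡⟨ cong (λ z → suc (suc (f + length ns + z))) (length-unfactor (factors ns l us)) ⟩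
  suc (suc (f + length ns + (weight ns + (weight us + size l))))
    ≡⟨ cong (λ z → suc (suc (f + length ns + (weight ns + (z + size l))))) (weight-unpair ps lo) ⟩
  suc (suc (f + length ns + (weight ns + (pairWeight ps + maybeWeight lo + size l))))
    ≡⟨ cong (suc ∘ suc) (rearrange f (length ns) (weight ns) (pairWeight ps) (maybeWeight lo) (size l)) ⟩
  suc (suc (f + size l + (weight ns + length ns + maybeWeight lo) + pairWeight ps))
    ≡⟨ cong (λ z → suc (suc (f + size l + z + pairWeight ps))) (size-unarches ns lo) ⟨
  suc (suc (f + size l + size (unarches ns lo) + pairWeight ps))
    ≡⟨ cong (λ z → suc (suc (f + size l + size z + pairWeight ps))) (unarches-arches r) ⟩
  humpSize (pieces f l ps r) ∎
  where
  open ≡-Reasoning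
  ns = proj₁ (arches r)
  lo = proj₂ (arches r)
  us = unpair ps lo
  rearrange : ∀ f n w p m l → f + n + (w + (p + m + l)) ≡ f + l + (w + n + m) + p
  rearrange = solve-∀

BallotPieces : ℕ → Set
BallotPieces n = Σ (ℕ × Factorization) λ x → ballotSize x ≡ n

HumpPiecesOfSize↔BallotPieces : ∀ n → HumpPiecesOfSize n ↔ BallotPieces n
HumpPiecesOfSize↔BallotPieces n = Σ-↔ ≡-irrelevant ≡-irrelevant regroup ungroup
  (λ {p} size≡ → trans (ballotSize-regroup p) size≡)
  (λ {x} size≡ → trans (sym (ballotSize-regroup (ungroup x))) (trans (cong ballotSize (regroup∘ungroup x)) size≡))
  (λ {x} _ → regroup∘ungroup x)
  (λ {p} _ → ungroup∘regroup p)

FirstD : List Step → Set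
FirstD []      = ⊥
FirstD (U ∷ w) = FirstD w
FirstD (D ∷ w) = ⊤
FirstD (F ∷ w) = ⊥

FirstD-irrelevant : ∀ w → Irrelevant (FirstD w)
FirstD-irrelevant []      ()
FirstD-irrelevant (U ∷ w) = FirstD-irrelevant w
FirstD-irrelevant (D ∷ w) _ _ = refl
FirstD-irrelevant (F ∷ w) ()

BallotWords : ℕ → Set
BallotWords n = Σ (List Step) λ w → length w ≡ n × Nonneg 0 w × FirstD w

riseThenD : ℕ → List Step → List Step
riseThenD i v = U ∷ replicate i U ++ D ∷ v

leadingUps : List Step → ℕ × List Step
leadingUps (U ∷ w) = let (i , v) = leadingUps w in suc i , v
leadingUps (D ∷ v) = 0 , v
leadingUps _       = 0 , []

splitRise : List Step → ℕ × List Step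
splitRise (U ∷ w) = leadingUps w
splitRise _       = 0 , []

splitRise-riseThenD : ∀ i v → splitRise (riseThenD i v) ≡ (i , v)
splitRise-riseThenD zero    v = refl
splitRise-riseThenD (suc i) v = cong (λ (j , v′) → suc j , v′) (splitRise-riseThenD i v)

riseThenD-splitRise : ∀ w → Nonneg 0 w → FirstD w → riseThenD (proj₁ (splitRise w)) (proj₂ (splitRise w)) ≡ w
riseThenD-splitRise (U ∷ w) _ firstD = cong (U ∷_) (replicate-leadingUps w firstD)
  where
  replicate-leadingUps : ∀ w → FirstD w → replicate (proj₁ (leadingUps w)) U ++ D ∷ proj₂ (leadingUps w) ≡ w
  replicate-leadingUps (U ∷ w) firstD = cong (U ∷_) (replicate-leadingUps w firstD)
  replicate-leadingUps (D ∷ w) _      = refl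

Nonneg-riseThenD : ∀ i v → Nonneg 0 (riseThenD i v) ≡ Nonneg i v
Nonneg-riseThenD i v = trans (Nonneg-ups 1 i (D ∷ v)) (cong (λ h → Nonneg h (D ∷ v)) (+-comm i 1))
  where
  Nonneg-ups : ∀ h i s → Nonneg h (replicate i U ++ s) ≡ Nonneg (i + h) s
  Nonneg-ups h zero    s = refl
  Nonneg-ups h (suc i) s = trans (Nonneg-ups (suc h) i s) (cong (λ h′ → Nonneg h′ s) (+-suc i h))

FirstD-riseThenD : ∀ i v → FirstD (riseThenD i v)
FirstD-riseThenD zero    v = tt
FirstD-riseThenD (suc i) v = FirstD-riseThenD i v

ballotWord : ℕ × Factorization → List Step
ballotWord (ℓ , φ) = riseThenD (ℓ + length (downs φ)) (unfactor φ)

unballotWord : List Step → ℕ × Factorization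
unballotWord w = let (i , v) = splitRise w in i ∸ length (downs (factor v)) , factor v

ballotWord∘unballotWord : ∀ w → Nonneg 0 w → FirstD w → ballotWord (unballotWord w) ≡ w
ballotWord∘unballotWord w nonneg firstD = begin
  riseThenD (i ∸ d + d) (unfactor (factor v)) ≡⟨ cong₂ riseThenD (m∸n+n≡m d≤i) (unfactor-factor v) ⟩
  riseThenD i v                                 ≡⟨ riseThenD-splitRise w nonneg firstD ⟩
  w                                             ∎
  where
  open ≡-Reasoning
  i = proj₁ (splitRise w)
  v = proj₂ (splitRise w)
  d = length (downs (factor v))
  nonneg-v : Nonneg i (unfactor (factor v))
  nonneg-v = subst (Nonneg i) (sym (unfactor-factor v))
    (subst id (Nonneg-riseThenD i v) (subst (Nonneg 0) (sym (riseThenD-splitRise w nonneg firstD)) nonneg))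
  d≤i : d ≤ i
  d≤i = to (Nonneg-unfactor i (factor v)) nonneg-v

unballotWord∘ballotWord : ∀ x → unballotWord (ballotWord x) ≡ x
unballotWord∘ballotWord (ℓ , φ)
  rewrite splitRise-riseThenD (ℓ + length (downs φ)) (unfactor φ) | factor-unfactor φ
  = cong (_, φ) (m+n∸n≡m ℓ (length (downs φ)))

length-ballotWord : ∀ x → length (ballotWord x) ≡ ballotSize x
length-ballotWord (ℓ , φ) = cong suc (begin
  length (replicate i U ++ D ∷ unfactor φ)        ≡⟨ length-++ (replicate i U) ⟩
  length (replicate i U) + suc (length (unfactor φ)) ≡⟨ cong (_+ suc (length (unfactor φ))) (length-replicate i) ⟩
  i + suc (length (unfactor φ))                  ≡⟨ +-suc i (length (unfactor φ)) ⟩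
  suc (i + length (unfactor φ))                  ∎)
  where
  open ≡-Reasoning
  i = ℓ + length (downs φ)

BallotPieces↔BallotWords : ∀ n → BallotPieces n ↔ BallotWords n
BallotPieces↔BallotWords n = Σ-↔ ≡-irrelevant
  (λ {w} → ×-irrelevant ≡-irrelevant (×-irrelevant (Nonneg-irrelevant 0 w) (FirstD-irrelevant w)))
  ballotWord unballotWord
  (λ {(ℓ , φ)} size≡ →
     trans (length-ballotWord (ℓ , φ)) size≡ ,
     subst id (sym (Nonneg-riseThenD (ℓ + length (downs φ)) (unfactor φ)))
              (from (Nonneg-unfactor _ φ) (m≤n+m (length (downs φ)) ℓ)) ,
     FirstD-riseThenD (ℓ + length (downs φ)) (unfactor φ))
  (λ {w} (len , nonneg , firstD) →
     trans (sym (length-ballotWord (unballotWord w))) (trans (cong length (ballotWord∘unballotWord w nonneg firstD)) len))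
  (λ {w} (_ , nonneg , firstD) → ballotWord∘unballotWord w nonneg firstD)
  (λ {x} _ → unballotWord∘ballotWord x)

sorted-head<tail : ∀ {x xs} → Linked _<_ (x ∷ xs) → All (x <_) xs
sorted-head<tail [-]       = []
sorted-head<tail (x<y ∷ l) = Linkedₚ.Linked⇒All <-trans x<y l

sorted-head≤ : ∀ {x xs z} → Linked _<_ (x ∷ xs) → z ∈ x ∷ xs → x ≤ z
sorted-head≤ l (here refl) = ≤-refl
sorted-head≤ l (there z∈) = <⇒≤ (All.lookup (sorted-head<tail l) z∈)

sorted-∷⊆∷⇒⊆ : ∀ {x us vs} → Linked _<_ (x ∷ us) → (∀ {z} → z ∈ x ∷ us → z ∈ x ∷ vs) →
               ∀ {z} → z ∈ us → z ∈ vs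
sorted-∷⊆∷⇒⊆ lu ⊆ z∈ with ⊆ (there z∈)
... | here refl = ⊥-elim (<-irrefl refl (All.lookup (sorted-head<tail lu) z∈))
... | there z∈′ = z∈′

sorted-ext : ∀ {xs ys} → Linked _<_ xs → Linked _<_ ys →
  (∀ {z} → z ∈ xs → z ∈ ys) → (∀ {z} → z ∈ ys → z ∈ xs) → xs ≡ ys
sorted-ext {[]}     {[]}     _  _  _    _    = refl
sorted-ext {[]}     {y ∷ ys} _  _  _    ys⊆ with () ← ys⊆ (here refl)
sorted-ext {x ∷ xs} {[]}     _  _  xs⊆  _    with () ← xs⊆ (here refl)
sorted-ext {x ∷ xs} {y ∷ ys} lx ly xs⊆ ys⊆
  with ≤-antisym (sorted-head≤ ly (xs⊆ (here refl))) (sorted-head≤ lx (ys⊆ (here refl)))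
... | refl = cong (x ∷_) (sorted-ext (Linked.tail lx) (Linked.tail ly) (sorted-∷⊆∷⇒⊆ lx xs⊆) (sorted-∷⊆∷⇒⊆ ly ys⊆))

occ-++ : ∀ m xs ys → occ m (xs ++ ys) ≡ occ m xs + occ m ys
occ-++ m xs ys = trans (cong length (filter-++ (_≟ m) xs ys)) (length-++ (filter (_≟ m) xs))

occ-++₃ : ∀ m xs ys zs → occ m (xs ++ ys ++ zs) ≡ occ m xs + (occ m ys + occ m zs)
occ-++₃ m xs ys zs = trans (occ-++ m xs (ys ++ zs)) (cong (occ m xs +_) (occ-++ m ys zs))

occ-∷-≡ : ∀ m xs → occ m (m ∷ xs) ≡ suc (occ m xs)
occ-∷-≡ m xs = cong length (filter-accept (_≟ m) refl)

occ-∷-≢ : ∀ {m y} xs → y ≢ m → occ m (y ∷ xs) ≡ occ m xs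
occ-∷-≢ {m} xs y≢m = cong length (filter-reject (_≟ m) y≢m)

occ-∉ : ∀ {m} xs → m ∉ xs → occ m xs ≡ 0
occ-∉ []       _   = refl
occ-∉ {m} (y ∷ xs) m∉ = trans (occ-∷-≢ xs (λ y≡m → m∉ (here (sym y≡m)))) (occ-∉ xs (m∉ ∘ there))

∈⇒1≤occ : ∀ {m xs} → m ∈ xs → 1 ≤ occ m xs
∈⇒1≤occ {m} {_ ∷ xs} (here refl) = subst (1 ≤_) (sym (occ-∷-≡ m xs)) (s≤s z≤n)
∈⇒1≤occ {m} {y ∷ xs} (there m∈) with y ≟ m
... | yes refl = ≤-trans (∈⇒1≤occ m∈) (≤-trans (n≤1+n _) (≤-reflexive (sym (occ-∷-≡ m xs))))
... | no y≢m   = ≤-trans (∈⇒1≤occ m∈) (≤-reflexive (sym (occ-∷-≢ xs y≢m)))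

occ≡1⇒∈ : ∀ {m} xs → occ m xs ≡ 1 → m ∈ xs
occ≡1⇒∈ {m} xs occ≡1 with m ∈? xs
... | yes m∈ = m∈
... | no m∉  = ⊥-elim (0≢1+n (trans (sym (occ-∉ xs m∉)) occ≡1))

_≟ₛ_ : DecidableEquality Step
U ≟ₛ U = yes refl
U ≟ₛ D = no λ ()
U ≟ₛ F = no λ ()
D ≟ₛ U = no λ ()
D ≟ₛ D = yes refl
D ≟ₛ F = no λ ()
F ≟ₛ U = no λ ()
F ≟ₛ D = no λ ()
F ≟ₛ F = yes refl

positions : Step → ℕ → List Step → List ℕ
positions s k []      = []
positions s k (y ∷ w) = if does (y ≟ₛ s) then k ∷ positions s (suc k) w else positions s (suc k) w

positions-≥ : ∀ s k w → All (k ≤_) (positions s k w)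
positions-≥ s k []      = []
positions-≥ s k (y ∷ w) with y ≟ₛ s
... | yes _ = ≤-refl ∷ All.map (≤-trans (n≤1+n k)) (positions-≥ s (suc k) w)
... | no  _ = All.map (≤-trans (n≤1+n k)) (positions-≥ s (suc k) w)

positions-sorted : ∀ s k w → Linked _<_ (positions s k w)
positions-sorted s k []      = []
positions-sorted s k (y ∷ w) with y ≟ₛ s
... | no  _ = positions-sorted s (suc k) w
... | yes _ = k<all ∷′ positions-sorted s (suc k) w
  where
  k<all : Connected _<_ (just k) (List.head (positions s (suc k) w))
  k<all with positions s (suc k) w | positions-≥ s (suc k) w
  ... | []    | _       = just-nothing
  ... | _ ∷ _ | k<x ∷ _ = just k<x

k∉positions-suc : ∀ s k w → k ∉ positions s (suc k) w
k∉positions-suc s k w k∈ = 1+n≰n (All.lookup (positions-≥ s (suc k) w) k∈)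

range : ℕ → ℕ → List ℕ
range k zero    = []
range k (suc m) = k ∷ range (suc k) m

length-range : ∀ k m → length (range k m) ≡ m
length-range k zero    = refl
length-range k (suc m) = cong suc (length-range (suc k) m)

letterAt : List ℕ → List ℕ → ℕ → Step
letterAt r₁ r₂ i = if does (i ∈? r₁) then U else if does (i ∈? r₂) then D else F

letterAt-cong : ∀ {r₁ r₂ r₁′ r₂′} i → (i ∈ r₁ → i ∈ r₁′) → (i ∈ r₁′ → i ∈ r₁) →
  (i ∈ r₂ → i ∈ r₂′) → (i ∈ r₂′ → i ∈ r₂) → letterAt r₁ r₂ i ≡ letterAt r₁′ r₂′ i
letterAt-cong {r₁} {r₂} {r₁′} {r₂′} i to₁ from₁ to₂ from₂ with i ∈? r₁ | i ∈? r₁′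
... | yes p | no ¬q = ⊥-elim (¬q (to₁ p))
... | no ¬p | yes q = ⊥-elim (¬p (from₁ q))
... | yes _ | yes _ = refl
... | no _  | no _ with i ∈? r₂ | i ∈? r₂′
...   | yes p | no ¬q = ⊥-elim (¬q (to₂ p))
...   | no ¬p | yes q = ⊥-elim (¬p (from₂ q))
...   | yes _ | yes _ = refl
...   | no _  | no _  = refl

∈-positions-∷ : ∀ s y k w {i} → k < i → i ∈ positions s k (y ∷ w) → i ∈ positions s (suc k) w
∈-positions-∷ s y k w k<i i∈ with y ≟ₛ s | i∈
... | no _  | i∈′       = i∈′
... | yes _ | here refl = ⊥-elim (<-irrefl refl k<i)
... | yes _ | there i∈′ = i∈′

∈-positions-∷⁺ : ∀ s y k w {i} → i ∈ positions s (suc k) w → i ∈ positions s k (y ∷ w)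
∈-positions-∷⁺ s y k w i∈ with y ≟ₛ s
... | no  _ = i∈
... | yes _ = there i∈

letterAt-U : ∀ r₁ r₂ i → i ∈ r₁ → letterAt r₁ r₂ i ≡ U
letterAt-U r₁ r₂ i i∈r₁ with i ∈? r₁
... | yes _   = refl
... | no i∉r₁ = ⊥-elim (i∉r₁ i∈r₁)

letterAt-D : ∀ r₁ r₂ i → i ∉ r₁ → i ∈ r₂ → letterAt r₁ r₂ i ≡ D
letterAt-D r₁ r₂ i i∉r₁ i∈r₂ with i ∈? r₁ | i ∈? r₂
... | yes i∈r₁ | _       = ⊥-elim (i∉r₁ i∈r₁)
... | no _     | yes _   = refl
... | no _     | no i∉r₂ = ⊥-elim (i∉r₂ i∈r₂)

letterAt-F : ∀ r₁ r₂ i → i ∉ r₁ → i ∉ r₂ → letterAt r₁ r₂ i ≡ F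
letterAt-F r₁ r₂ i i∉r₁ i∉r₂ with i ∈? r₁ | i ∈? r₂
... | yes i∈r₁ | _       = ⊥-elim (i∉r₁ i∈r₁)
... | no _     | yes i∈r₂ = ⊥-elim (i∉r₂ i∈r₂)
... | no _     | no _    = refl

letterAt-positions-head : ∀ y k w → letterAt (positions U k (y ∷ w)) (positions D k (y ∷ w)) k ≡ y
letterAt-positions-head U k w =
  letterAt-U (k ∷ positions U (suc k) w) (positions D (suc k) w) k (here refl)
letterAt-positions-head D k w =
  letterAt-D (positions U (suc k) w) (k ∷ positions D (suc k) w) k (k∉positions-suc U k w) (here refl)
letterAt-positions-head F k w =
  letterAt-F (positions U (suc k) w) (positions D (suc k) w) k (k∉positions-suc U k w) (k∉positions-suc D k w)

word-positions : ∀ k w → map (letterAt (positions U k w) (positions D k w)) (range k (length w)) ≡ w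
word-positions k []      = refl
word-positions k (y ∷ w) =
  cong₂ _∷_ (letterAt-positions-head y k w) (trans (map-range-cong (suc k) (length w) shift) (word-positions (suc k) w))
  where
  map-range-cong : ∀ {f g : ℕ → Step} j m → (∀ i → j ≤ i → f i ≡ g i) →
                   map f (range j m) ≡ map g (range j m)
  map-range-cong j zero    f≗g = refl
  map-range-cong j (suc m) f≗g =
    cong₂ _∷_ (f≗g j ≤-refl) (map-range-cong (suc j) m (λ i j<i → f≗g i (<⇒≤ j<i)))
  shift : ∀ i → suc k ≤ i → letterAt (positions U k (y ∷ w)) (positions D k (y ∷ w)) i
                          ≡ letterAt (positions U (suc k) w) (positions D (suc k) w) i
  shift i k<i = letterAt-cong i (∈-positions-∷ U y k w k<i) (∈-positions-∷⁺ U y k w)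
                                (∈-positions-∷ D y k w k<i) (∈-positions-∷⁺ D y k w)

∈-positions-word : ∀ s (c : ℕ → Step) k m {x} →
  x ∈ positions s k (map c (range k m)) ⇔ (k ≤ x × x < k + m × c x ≡ s)
∈-positions-word s c k zero    {x} =
  mk⇔ (λ ()) (λ (k≤x , x<k+0 , _) → ⊥-elim (<⇒≱ (subst (x <_) (+-identityʳ k) x<k+0) k≤x))
∈-positions-word s c k (suc m) {x} = mk⇔ ⇒bounds bounds⇒
  where
  ih = ∈-positions-word s c (suc k) m {x}
  later : x ∈ positions s (suc k) (map c (range (suc k) m)) → k ≤ x × x < k + suc m × c x ≡ s
  later x∈ = let (k<x , x< , cx≡s) = to ih x∈ in <⇒≤ k<x , subst (x <_) (sym (+-suc k m)) x< , cx≡s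
  ⇒bounds : x ∈ positions s k (map c (range k (suc m))) → k ≤ x × x < k + suc m × c x ≡ s
  ⇒bounds x∈ with c k ≟ₛ s | x∈
  ... | yes ck≡s | here refl = ≤-refl , subst (k <_) (sym (+-suc k m)) (s≤s (m≤m+n k m)) , ck≡s
  ... | yes _    | there x∈′ = later x∈′
  ... | no _     | x∈′       = later x∈′
  bounds⇒ : k ≤ x × x < k + suc m × c x ≡ s → x ∈ positions s k (map c (range k (suc m)))
  bounds⇒ (k≤x , x< , cx≡s) with k ≟ x
  ... | no k≢x   = ∈-positions-∷⁺ s (c k) k (map c (range (suc k) m))
                     (from ih (≤∧≢⇒< k≤x k≢x , subst (x <_) (+-suc k m) x< , cx≡s))
  ... | yes refl with c x ≟ₛ s
  ...   | yes _   = here refl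
  ...   | no cx≢s = ⊥-elim (cx≢s cx≡s)

-- P holds the first-row entries not yet matched by second-row entries, so its length is the height reached.
ColLt-positions⇔Nonneg : ∀ P k w → All (_< k) P → ColLt (P ++ positions U k w) (positions D k w) ⇔ Nonneg (length P) w
ColLt-positions⇔Nonneg P       k []      _   = mk⇔ (λ _ → tt) (λ _ → tt)
ColLt-positions⇔Nonneg P       k (U ∷ w) P<k = begin
  ColLt (P ++ k ∷ positions U (suc k) w) (positions D (suc k) w)
    ≡⟨ cong (λ r → ColLt r (positions D (suc k) w)) (++-assoc P [ k ] _) ⟨
  ColLt ((P ++ [ k ]) ++ positions U (suc k) w) (positions D (suc k) w)
    ∼⟨ ColLt-positions⇔Nonneg (P ++ [ k ]) (suc k) w (Allₚ.++⁺ (All.map m≤n⇒m≤1+n P<k) (≤-refl ∷ [])) ⟩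
  Nonneg (length (P ++ [ k ])) w
    ≡⟨ cong (λ h → Nonneg h w) (trans (length-++ P) (+-comm (length P) 1)) ⟩
  Nonneg (suc (length P)) w
    ∎
  where open EquationalReasoning {k = equivalence}
ColLt-positions⇔Nonneg []      k (D ∷ w) _   = mk⇔ ColLt-fails (λ ())
  where
  ColLt-fails : ColLt (positions U (suc k) w) (k ∷ positions D (suc k) w) → ⊥
  ColLt-fails col with positions U (suc k) w | positions-≥ U (suc k) w
  ... | []    | _       = col
  ... | _ ∷ _ | k<x ∷ _ = <-asym k<x (proj₁ col)
ColLt-positions⇔Nonneg (p ∷ P) k (D ∷ w) (p<k ∷ P<k) =
  mk⇔ (λ (_ , col) → to ih col) (λ nonneg → p<k , from ih nonneg)
  where ih = ColLt-positions⇔Nonneg P (suc k) w (All.map m≤n⇒m≤1+n P<k)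
ColLt-positions⇔Nonneg P       k (F ∷ w) P<k = ColLt-positions⇔Nonneg P (suc k) w (All.map m≤n⇒m≤1+n P<k)

HeadLt : List ℕ → List ℕ → Set
HeadLt []      _       = ⊥
HeadLt (x ∷ _) []      = ⊤
HeadLt (x ∷ _) (y ∷ _) = x < y

FirstD⇔HeadLt-positions : ∀ k w → FirstD w ⇔ HeadLt (positions D k w) (positions F k w)
FirstD⇔HeadLt-positions k []      = mk⇔ (λ ()) (λ ())
FirstD⇔HeadLt-positions k (U ∷ w) = FirstD⇔HeadLt-positions (suc k) w
FirstD⇔HeadLt-positions k (D ∷ w) = mk⇔ (λ _ → k<F) (λ _ → tt)
  where
  k<F : HeadLt (k ∷ positions D (suc k) w) (positions F (suc k) w)
  k<F with positions F (suc k) w | positions-≥ F (suc k) w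
  ... | []    | _       = tt
  ... | _ ∷ _ | k<y ∷ _ = k<y
FirstD⇔HeadLt-positions k (F ∷ w) = mk⇔ (λ ()) F<D-fails
  where
  F<D-fails : HeadLt (positions D (suc k) w) (k ∷ positions F (suc k) w) → ⊥
  F<D-fails headLt with positions D (suc k) w | positions-≥ D (suc k) w
  ... | []    | _       = headLt
  ... | _ ∷ _ | k<x ∷ _ = <-asym k<x headLt

length-positions : ∀ k w → length (positions U k w) + (length (positions D k w) + length (positions F k w)) ≡ length w
length-positions k []      = refl
length-positions k (U ∷ w) = cong suc (length-positions (suc k) w)
length-positions k (D ∷ w) = trans (+-suc _ _) (cong suc (length-positions (suc k) w))
length-positions k (F ∷ w) = trans (cong (length (positions U (suc k) w) +_) (+-suc _ _))
                                   (trans (+-suc _ _) (cong suc (length-positions (suc k) w)))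

occ-positions-suc : ∀ s k w → occ k (positions s (suc k) w) ≡ 0
occ-positions-suc s k w = occ-∉ (positions s (suc k) w) (k∉positions-suc s k w)

occ-positions-head : ∀ y k w →
  occ k (positions U k (y ∷ w)) + (occ k (positions D k (y ∷ w)) + occ k (positions F k (y ∷ w))) ≡ 1
occ-positions-head U k w =
  cong₂ _+_ (trans (occ-∷-≡ k _) (cong suc (occ-positions-suc U k w)))
            (cong₂ _+_ (occ-positions-suc D k w) (occ-positions-suc F k w))
occ-positions-head D k w =
  cong₂ _+_ (occ-positions-suc U k w)
            (cong₂ _+_ (trans (occ-∷-≡ k _) (cong suc (occ-positions-suc D k w))) (occ-positions-suc F k w))
occ-positions-head F k w =
  cong₂ _+_ (occ-positions-suc U k w)
            (cong₂ _+_ (occ-positions-suc D k w) (trans (occ-∷-≡ k _) (cong suc (occ-positions-suc F k w))))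

occ-positions-∷ : ∀ s y k w {m} → k ≢ m → occ m (positions s k (y ∷ w)) ≡ occ m (positions s (suc k) w)
occ-positions-∷ s y k w k≢m with y ≟ₛ s
... | yes _ = occ-∷-≢ (positions s (suc k) w) k≢m
... | no  _ = refl

occ-positions : ∀ k w m → k ≤ m → m < k + length w →
  occ m (positions U k w) + (occ m (positions D k w) + occ m (positions F k w)) ≡ 1
occ-positions k []      m k≤m m<k+0 = ⊥-elim (<⇒≱ (subst (m <_) (+-identityʳ k) m<k+0) k≤m)
occ-positions k (y ∷ w) m k≤m m<    with k ≟ m
... | yes refl = occ-positions-head y k w
... | no k≢m   =
  trans (cong₂ _+_ (occ-positions-∷ U y k w k≢m) (cong₂ _+_ (occ-positions-∷ D y k w k≢m) (occ-positions-∷ F y k w k≢m)))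
        (occ-positions (suc k) w m (≤∧≢⇒< k≤m k≢m) (subst (m <_) (+-suc k (length w)) m<))

record HookRows (n : ℕ) (r₁ r₂ cs : List ℕ) : Set where
  field
    sorted₁ : Linked _<_ r₁
    sorted₂ : Linked _<_ r₂
    sortedᶜ : Linked _<_ cs
    columns : ColLt r₁ r₂
    corner  : HeadLt r₂ cs
    cells   : length (r₁ ++ r₂ ++ cs) ≡ n
    once    : All (λ m → occ m (r₁ ++ r₂ ++ cs) ≡ 1) (applyUpTo suc n)
open HookRows

ColLt-irrelevant : ∀ xs ys → Irrelevant (ColLt xs ys)
ColLt-irrelevant xs       []       _ _ = refl
ColLt-irrelevant []       (y ∷ ys) ()
ColLt-irrelevant (x ∷ xs) (y ∷ ys) = ×-irrelevant ≤-irrelevant (ColLt-irrelevant xs ys)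

HeadLt-irrelevant : ∀ xs ys → Irrelevant (HeadLt xs ys)
HeadLt-irrelevant []      _       ()
HeadLt-irrelevant (x ∷ _) []      _ _ = refl
HeadLt-irrelevant (x ∷ _) (y ∷ _) = ≤-irrelevant

HookRows-irrelevant : ∀ {n r₁ r₂ cs} → Irrelevant (HookRows n r₁ r₂ cs)
HookRows-irrelevant {n} {r₁} {r₂} {cs} h h′
  with Linked.irrelevant <-irrelevant (sorted₁ h) (sorted₁ h′)
     | Linked.irrelevant <-irrelevant (sorted₂ h) (sorted₂ h′)
     | Linked.irrelevant <-irrelevant (sortedᶜ h) (sortedᶜ h′)
     | ColLt-irrelevant r₁ r₂ (columns h) (columns h′)
     | HeadLt-irrelevant r₂ cs (corner h) (corner h′)
     | ≡-irrelevant (cells h) (cells h′)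
     | All.irrelevant ≡-irrelevant (once h) (once h′)
... | refl | refl | refl | refl | refl | refl | refl = refl

HookTriples : ℕ → Set
HookTriples n = Σ (List ℕ × List ℕ × List ℕ) λ (r₁ , r₂ , cs) → HookRows n r₁ r₂ cs

rowsOf : List Step → List ℕ × List ℕ × List ℕ
rowsOf w = positions U 1 w , positions D 1 w , positions F 1 w

hookRows-rowsOf : ∀ n w → length w ≡ n → Nonneg 0 w → FirstD w →
  let (r₁ , r₂ , cs) = rowsOf w in HookRows n r₁ r₂ cs
hookRows-rowsOf n w refl nonneg firstD = record
  { sorted₁ = positions-sorted U 1 w
  ; sorted₂ = positions-sorted D 1 w
  ; sortedᶜ = positions-sorted F 1 w
  ; columns = from (ColLt-positions⇔Nonneg [] 1 w []) nonneg
  ; corner  = to (FirstD⇔HeadLt-positions 1 w) firstD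
  ; cells   = trans (length-++ pU) (trans (cong (length pU +_) (length-++ pD)) (length-positions 1 w))
  ; once    = Allₚ.applyUpTo⁺₁ suc (length w) λ {i} i<n →
      trans (occ-++₃ (suc i) pU pD pF) (occ-positions 1 w (suc i) (s≤s z≤n) (s≤s i<n))
  }
  where
  pU = positions U 1 w
  pD = positions D 1 w
  pF = positions F 1 w

covers⇒≤length : ∀ n L → (∀ {j} → 1 ≤ j → j ≤ n → j ∈ L) → n ≤ length L
covers⇒≤length zero    L _      = z≤n
covers⇒≤length (suc n) L covers = begin-strict
  n                  ≤⟨ covers⇒≤length n (filter other? L) covers-below ⟩
  length (filter other? L) <⟨ filter-notAll other? L (Any.map (λ { refl ¬≡ → ¬≡ refl }) (covers (s≤s z≤n) ≤-refl)) ⟩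
  length L           ∎
  where
  open ≤-Reasoning
  other? = λ y → ¬? (y ≟ suc n)
  covers-below : ∀ {j} → 1 ≤ j → j ≤ n → j ∈ filter other? L
  covers-below 1≤j j≤n = ∈-filter⁺ other? (covers 1≤j (m≤n⇒m≤1+n j≤n)) (<⇒≢ (s≤s j≤n))

covers⇒bounded : ∀ n L → length L ≡ n → (∀ {j} → 1 ≤ j → j ≤ n → j ∈ L) →
                 ∀ {x} → x ∈ L → 1 ≤ x × x ≤ n
covers⇒bounded n L refl covers {x} x∈L with 1 ≤? x ×-dec x ≤? length L
... | yes bounded  = bounded
... | no unbounded = ⊥-elim (<-irrefl refl (begin-strict
  length L                   ≤⟨ covers⇒≤length (length L) (filter inRange? L) covers-inRange ⟩
  length (filter inRange? L) <⟨ filter-notAll inRange? L (Any.map (λ { refl → unbounded }) x∈L) ⟩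
  length L                   ∎))
  where
  open ≤-Reasoning
  inRange? : ∀ y → Dec (1 ≤ y × y ≤ length L)
  inRange? y = 1 ≤? y ×-dec y ≤? length L
  covers-inRange : ∀ {j} → 1 ≤ j → j ≤ length L → j ∈ filter inRange? L
  covers-inRange 1≤j j≤n = ∈-filter⁺ inRange? (covers 1≤j j≤n) (1≤j , j≤n)

letterAt≡U : ∀ r₁ r₂ {i} → letterAt r₁ r₂ i ≡ U → i ∈ r₁
letterAt≡U r₁ r₂ {i} eq with i ∈? r₁ | i ∈? r₂
... | yes i∈r₁ | _ = i∈r₁
letterAt≡U _ _ () | no _ | yes _
letterAt≡U _ _ () | no _ | no _

letterAt≡D : ∀ r₁ r₂ {i} → letterAt r₁ r₂ i ≡ D → i ∉ r₁ × i ∈ r₂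
letterAt≡D r₁ r₂ {i} eq with i ∈? r₁ | i ∈? r₂
letterAt≡D _ _ () | yes _ | _
... | no i∉r₁ | yes i∈r₂ = i∉r₁ , i∈r₂
letterAt≡D _ _ () | no _ | no _

letterAt≡F : ∀ r₁ r₂ {i} → letterAt r₁ r₂ i ≡ F → i ∉ r₁ × i ∉ r₂
letterAt≡F r₁ r₂ {i} eq with i ∈? r₁ | i ∈? r₂
letterAt≡F _ _ () | yes _ | _
letterAt≡F _ _ () | no _ | yes _
... | no i∉r₁ | no i∉r₂ = i∉r₁ , i∉r₂

wordOf : ℕ → List ℕ × List ℕ × List ℕ → List Step
wordOf n (r₁ , r₂ , _) = map (letterAt r₁ r₂) (range 1 n)

module WordOfHookRows {n r₁ r₂ cs} (h : HookRows n r₁ r₂ cs) where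

  cellList = r₁ ++ r₂ ++ cs
  w = wordOf n (r₁ , r₂ , cs)

  occ≡1 : ∀ {j} → 1 ≤ j → j ≤ n → occ j cellList ≡ 1
  occ≡1 {suc i} _ j≤n = Allₚ.applyUpTo⁻ suc n (once h) j≤n

  covered : ∀ {j} → 1 ≤ j → j ≤ n → j ∈ cellList
  covered 1≤j j≤n = occ≡1⇒∈ cellList (occ≡1 1≤j j≤n)

  bounded : ∀ {x} → x ∈ cellList → 1 ≤ x × x < 1 + n
  bounded x∈ = let (1≤x , x≤n) = covers⇒bounded n cellList (cells h) covered x∈ in 1≤x , s≤s x≤n

  in₁ : ∀ {x} → x ∈ r₁ → x ∈ cellList
  in₁ = ∈-++⁺ˡ
  in₂ : ∀ {x} → x ∈ r₂ → x ∈ cellList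
  in₂ = ∈-++⁺ʳ r₁ ∘ ∈-++⁺ˡ
  inᶜ : ∀ {x} → x ∈ cs → x ∈ cellList
  inᶜ = ∈-++⁺ʳ r₁ ∘ ∈-++⁺ʳ r₂

  not-counted-twice : ∀ {x} → x ∈ cellList → 2 ≤ occ x r₁ + (occ x r₂ + occ x cs) → ⊥
  not-counted-twice {x} x∈ 2≤ = let (1≤x , x<1+n) = bounded x∈ in
    <-irrefl refl (≤-trans 2≤ (≤-reflexive (trans (sym (occ-++₃ x r₁ r₂ cs)) (occ≡1 1≤x (s≤s⁻¹ x<1+n)))))

  ∉₁-of-∈₂ : ∀ {x} → x ∈ r₂ → x ∉ r₁
  ∉₁-of-∈₂ x∈r₂ x∈r₁ =
    not-counted-twice (in₂ x∈r₂) (+-mono-≤ (∈⇒1≤occ x∈r₁) (m≤n⇒m≤n+o (occ _ cs) (∈⇒1≤occ x∈r₂)))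

  ∉₁-of-∈ᶜ : ∀ {x} → x ∈ cs → x ∉ r₁
  ∉₁-of-∈ᶜ x∈cs x∈r₁ =
    not-counted-twice (inᶜ x∈cs) (+-mono-≤ (∈⇒1≤occ x∈r₁) (m≤n⇒m≤o+n (occ _ r₂) (∈⇒1≤occ x∈cs)))

  ∉₂-of-∈ᶜ : ∀ {x} → x ∈ cs → x ∉ r₂
  ∉₂-of-∈ᶜ x∈cs x∈r₂ =
    not-counted-twice (inᶜ x∈cs) (m≤n⇒m≤o+n (occ _ r₁) (+-mono-≤ (∈⇒1≤occ x∈r₂) (∈⇒1≤occ x∈cs)))

  ∈-positions-w : ∀ s {x} → x ∈ positions s 1 w ⇔ (1 ≤ x × x < 1 + n × letterAt r₁ r₂ x ≡ s)
  ∈-positions-w s = ∈-positions-word s (letterAt r₁ r₂) 1 n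

  positionsU : positions U 1 w ≡ r₁
  positionsU = sorted-ext (positions-sorted U 1 w) (sorted₁ h)
    (λ x∈ → letterAt≡U r₁ r₂ (proj₂ (proj₂ (to (∈-positions-w U) x∈))))
    (λ x∈ → let (1≤x , x<) = bounded (in₁ x∈) in from (∈-positions-w U) (1≤x , x< , letterAt-U r₁ r₂ _ x∈))

  positionsD : positions D 1 w ≡ r₂
  positionsD = sorted-ext (positions-sorted D 1 w) (sorted₂ h)
    (λ x∈ → proj₂ (letterAt≡D r₁ r₂ (proj₂ (proj₂ (to (∈-positions-w D) x∈)))))
    (λ x∈ → let (1≤x , x<) = bounded (in₂ x∈) in
            from (∈-positions-w D) (1≤x , x< , letterAt-D r₁ r₂ _ (∉₁-of-∈₂ x∈) x∈))

  positionsF : positions F 1 w ≡ cs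
  positionsF = sorted-ext (positions-sorted F 1 w) (sortedᶜ h) ⇒cs
    (λ x∈ → let (1≤x , x<) = bounded (inᶜ x∈) in
            from (∈-positions-w F) (1≤x , x< , letterAt-F r₁ r₂ _ (∉₁-of-∈ᶜ x∈) (∉₂-of-∈ᶜ x∈)))
    where
    ⇒cs : ∀ {x} → x ∈ positions F 1 w → x ∈ cs
    ⇒cs x∈ with to (∈-positions-w F) x∈
    ... | 1≤x , x< , isF with letterAt≡F r₁ r₂ isF | ∈-++⁻ r₁ (covered 1≤x (s≤s⁻¹ x<))
    ...   | x∉r₁ , _    | inj₁ x∈r₁ = ⊥-elim (x∉r₁ x∈r₁)
    ...   | _    , x∉r₂ | inj₂ x∈rest with ∈-++⁻ r₂ x∈rest
    ...     | inj₁ x∈r₂ = ⊥-elim (x∉r₂ x∈r₂)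
    ...     | inj₂ x∈cs = x∈cs

  rowsOf-w : rowsOf w ≡ (r₁ , r₂ , cs)
  rowsOf-w = cong₂ _,_ positionsU (cong₂ _,_ positionsD positionsF)

  length-w : length w ≡ n
  length-w = trans (length-map (letterAt r₁ r₂) (range 1 n)) (length-range 1 n)

  nonneg-w : Nonneg 0 w
  nonneg-w = to (ColLt-positions⇔Nonneg [] 1 w []) (subst₂ ColLt (sym positionsU) (sym positionsD) (columns h))

  firstD-w : FirstD w
  firstD-w = from (FirstD⇔HeadLt-positions 1 w) (subst₂ HeadLt (sym positionsD) (sym positionsF) (corner h))

BallotWords↔HookTriples : ∀ n → BallotWords n ↔ HookTriples n
BallotWords↔HookTriples n = Σ-↔
  (λ {w} → ×-irrelevant ≡-irrelevant (×-irrelevant (Nonneg-irrelevant 0 w) (FirstD-irrelevant w))) HookRows-irrelevant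
  rowsOf (wordOf n)
  (λ {w} (len , nonneg , firstD) → hookRows-rowsOf n w len nonneg firstD)
  (λ (h : HookRows n _ _ _) → let open WordOfHookRows h in length-w , nonneg-w , firstD-w)
  (λ (h : HookRows n _ _ _) → WordOfHookRows.rowsOf-w h)
  (λ {w} (len , _) → subst (λ m → wordOf m (rowsOf w) ≡ w) len (word-positions 1 w))

hookTableau : List ℕ × List ℕ × List ℕ → List (List ℕ)
hookTableau (r₁ , r₂ , cs) = r₁ ∷ r₂ ∷ map [_] cs

ColLt-length : ∀ xs ys → ColLt xs ys → length ys ≤ length xs
ColLt-length xs       []       _         = z≤n
ColLt-length (x ∷ xs) (y ∷ ys) (_ , col) = s≤s (ColLt-length xs ys col)

HeadLt-nonempty : ∀ xs ys → HeadLt xs ys → 1 ≤ length xs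
HeadLt-nonempty (x ∷ xs) _ _ = s≤s z≤n

singletons-ColLt : ∀ {cs} → Linked _<_ cs → Linked ColLt (map [_] cs)
singletons-ColLt sorted = Linkedₚ.map⁺ (Linked.map (_, tt) sorted)

firstColumn-ColLt : ∀ {r cs} → HeadLt r cs → Linked _<_ cs → Linked ColLt (r ∷ map [_] cs)
firstColumn-ColLt {r}     {[]}    _   _      = [-]
firstColumn-ColLt {_ ∷ _} {_ ∷ _} x<c sorted = (x<c , tt) ∷ singletons-ColLt sorted

HookRows⇒IsSYT : ∀ {n r₁ r₂ cs} → HookRows n r₁ r₂ cs → IsSYT n (hookTableau (r₁ , r₂ , cs))
HookRows⇒IsSYT {n} {r₁} {r₂} {cs} h =
  (≤-trans 1≤r₂ r₂≤r₁ ∷ 1≤r₂ ∷ Allₚ.map⁺ (All.universal (λ _ → s≤s z≤n) cs)) ,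
  (r₂≤r₁ ∷ shape-tail 1≤r₂ cs) ,
  (sorted₁ h ∷ sorted₂ h ∷ Allₚ.map⁺ (All.universal (λ _ → [-]) cs)) ,
  (columns h ∷ firstColumn-ColLt (corner h) (sortedᶜ h)) ,
  subst (λ rest → length (r₁ ++ r₂ ++ rest) ≡ n) (sym (concat-map-[ cs ])) (cells h) ,
  subst (λ rest → All (λ m → occ m (r₁ ++ r₂ ++ rest) ≡ 1) (applyUpTo suc n)) (sym (concat-map-[ cs ])) (once h)
  where
  1≤r₂ = HeadLt-nonempty r₂ cs (corner h)
  r₂≤r₁ = ColLt-length r₁ r₂ (columns h)
  shape-tail : ∀ {d} → 1 ≤ d → ∀ cs → Linked _≥_ (d ∷ map length (map [_] cs))
  shape-tail 1≤d []       = [-]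
  shape-tail 1≤d (c ∷ cs) = 1≤d ∷ shape-tail ≤-refl cs

firstColumn-ColLt⁻ : ∀ {r cs} → 1 ≤ length r → Linked ColLt (r ∷ map [_] cs) → HeadLt r cs × Linked _<_ cs
firstColumn-ColLt⁻ {_ ∷ _} {[]}    _ _               = tt , []
firstColumn-ColLt⁻ {_ ∷ _} {_ ∷ _} _ ((x<c , _) ∷ l) = x<c , Linked.map proj₁ (Linkedₚ.map⁻ l)

IsSYT⇒HookRows : ∀ {n r₁ r₂ cs} → IsSYT n (hookTableau (r₁ , r₂ , cs)) → HookRows n r₁ r₂ cs
IsSYT⇒HookRows {n} {r₁} {r₂} {cs} (_ ∷ 1≤r₂ ∷ _ , _ , s₁ ∷ s₂ ∷ _ , c₁₂ ∷ col , len , once) = record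
  { sorted₁ = s₁
  ; sorted₂ = s₂
  ; sortedᶜ = proj₂ (firstColumn-ColLt⁻ 1≤r₂ col)
  ; columns = c₁₂
  ; corner  = proj₁ (firstColumn-ColLt⁻ 1≤r₂ col)
  ; cells   = subst (λ rest → length (r₁ ++ r₂ ++ rest) ≡ n) (concat-map-[ cs ]) len
  ; once    = subst (λ rest → All (λ m → occ m (r₁ ++ r₂ ++ rest) ≡ 1) (applyUpTo suc n)) (concat-map-[ cs ]) once
  }

IsSYT-irrelevant : ∀ n T → Irrelevant (IsSYT n T)
IsSYT-irrelevant n T =
  ×-irrelevant (All.irrelevant ≤-irrelevant) (×-irrelevant (Linked.irrelevant ≤-irrelevant)
  (×-irrelevant (All.irrelevant (Linked.irrelevant <-irrelevant)) (×-irrelevant (Linked.irrelevant (ColLt-irrelevant _ _))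
  (×-irrelevant ≡-irrelevant (All.irrelevant ≡-irrelevant)))))

hookRows : List (List ℕ) → List ℕ × List ℕ × List ℕ
hookRows (r₁ ∷ r₂ ∷ rest) = r₁ , r₂ , concat rest
hookRows _                = [] , [] , []

hookRows-hookTableau : ∀ t → hookRows (hookTableau t) ≡ t
hookRows-hookTableau (r₁ , r₂ , cs) = cong (λ cs′ → r₁ , r₂ , cs′) (concat-map-[ cs ])

singleton-rows : ∀ (rest : List (List ℕ)) → All (λ r → 1 ≤ length r) rest → Linked _≥_ (map length rest) →
  part (map length rest) 0 ≤ 1 → map [_] (concat rest) ≡ rest
singleton-rows []                   _        _  _ = refl
singleton-rows ((a ∷ []) ∷ rest)    (_ ∷ ne) lk _ =
  cong ([ a ] ∷_) (singleton-rows rest ne (Linked.tail lk) (next≤1 rest lk))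
  where
  next≤1 : ∀ rest → Linked _≥_ (1 ∷ map length rest) → part (map length rest) 0 ≤ 1
  next≤1 []      _  = z≤n
  next≤1 (_ ∷ _) lk = Linked.head lk
singleton-rows ((_ ∷ _ ∷ _) ∷ rest) _        _  (s≤s ())

-- 2 ≤ n and k ≤ n ∸ 2 exclude a tableau with a single row.
hookTableau-hookRows : ∀ {n k} T → 2 ≤ n → k ≤ n ∸ 2 → IsSYT n T → part (shape T) 2 ≤ 1 →
  part (shape T) 0 ≡ part (shape T) 1 + k → hookTableau (hookRows T) ≡ T
hookTableau-hookRows []         2≤n _   (_ , _ , _ , _ , refl , _) _ _ with () ← 2≤n
hookTableau-hookRows {n} (r₁ ∷ []) 2≤n k≤n∸2 (_ , _ , _ , _ , len , _) _ r₁≡k = ⊥-elim (n≰n∸2 2≤n (begin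
  n                 ≡⟨ len ⟨
  length (r₁ ++ []) ≡⟨ cong length (++-identityʳ r₁) ⟩
  length r₁         ≡⟨ r₁≡k ⟩
  _                 ≤⟨ k≤n∸2 ⟩
  n ∸ 2             ∎))
  where
  open ≤-Reasoning
  n≰n∸2 : ∀ {n} → 2 ≤ n → n ≤ n ∸ 2 → ⊥
  n≰n∸2 {suc (suc m)} _ le = 1+n≰n (≤-trans (n≤1+n (suc m)) le)
hookTableau-hookRows (r₁ ∷ r₂ ∷ rest) _ _ (ne , lk , _) p₂≤1 _ =
  cong (λ rest′ → r₁ ∷ r₂ ∷ rest′) (singleton-rows rest (All.tail (All.tail ne)) (Linked.tail (Linked.tail lk)) p₂≤1)

excess≤n∸2 : ∀ {a b n} → 1 ≤ b → a + b ≤ n → a ∸ b ≤ n ∸ 2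
excess≤n∸2 {a} {b} {n} 1≤b a+b≤n = begin
  a ∸ b      ≤⟨ ∸-monoʳ-≤ a 1≤b ⟩
  a ∸ 1      ≤⟨ ∸-monoˡ-≤ 1 (m+n≤o⇒m≤o∸n a (≤-trans (+-monoʳ-≤ a 1≤b) a+b≤n)) ⟩
  n ∸ 1 ∸ 1  ≡⟨ ∸-+-assoc n 1 1 ⟩
  n ∸ 2      ∎
  where open ≤-Reasoning

S21Union-≡ : ∀ {n k k′ T T′} → k ≡ k′ → T ≡ T′ → ∀ {a a′ s s′ p p′ q q′} →
  _≡_ {A = S21Union n} (k , a , T , s , p , q) (k′ , a′ , T′ , s′ , p′ , q′)
S21Union-≡ {n} {T = T} refl refl {a} {a′} {s} {s′} {p} {p′} {q} {q′}
  with ≤-irrelevant a a′ | IsSYT-irrelevant n T s s′ | ≤-irrelevant p p′ | ≡-irrelevant q q′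
... | refl | refl | refl | refl = refl

part-singletons≤1 : ∀ (cs : List ℕ) → part (map length (map [_] cs)) 0 ≤ 1
part-singletons≤1 []      = z≤n
part-singletons≤1 (_ ∷ _) = ≤-refl

toS21 : ∀ {n} → HookTriples n → S21Union n
toS21 (t@(r₁ , r₂ , cs) , h) =
  length r₁ ∸ length r₂ , excess≤n∸2 1≤r₂ (≤-trans r₁+r₂≤ (≤-reflexive (cells h))) ,
  hookTableau t , HookRows⇒IsSYT h , part-singletons≤1 cs , sym (m+[n∸m]≡n (ColLt-length r₁ r₂ (columns h)))
  where
  1≤r₂ = HeadLt-nonempty r₂ cs (corner h)
  r₁+r₂≤ : length r₁ + length r₂ ≤ length (r₁ ++ r₂ ++ cs)
  r₁+r₂≤ = ≤-trans (+-monoʳ-≤ (length r₁) (length-++-≤ˡ r₂)) (≤-reflexive (sym (length-++ r₁)))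

fromS21 : ∀ {n} → 2 ≤ n → S21Union n → HookTriples n
fromS21 {n} 2≤n (k , k≤ , T , syt , p₂≤1 , p₀≡) =
  hookRows T , IsSYT⇒HookRows (subst (IsSYT n) (sym (hookTableau-hookRows T 2≤n k≤ syt p₂≤1 p₀≡)) syt)

toS21∘fromS21 : ∀ {n} (2≤n : 2 ≤ n) x → toS21 (fromS21 2≤n x) ≡ x
toS21∘fromS21 2≤n (k , k≤ , T , syt , p₂≤1 , p₀≡) = S21Union-≡ excess≡k T≡
  where
  T≡ = hookTableau-hookRows T 2≤n k≤ syt p₂≤1 p₀≡
  r₁ = proj₁ (hookRows T)
  r₂ = proj₁ (proj₂ (hookRows T))
  excess≡k : length r₁ ∸ length r₂ ≡ k
  excess≡k = trans (cong (_∸ length r₂) (subst (λ T′ → part (shape T′) 0 ≡ part (shape T′) 1 + k) (sym T≡) p₀≡))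
                   (m+n∸m≡n (length r₂) k)

fromS21∘toS21 : ∀ {n} (2≤n : 2 ≤ n) x → fromS21 2≤n (toS21 x) ≡ x
fromS21∘toS21 2≤n (t , h) = Σ-≡-irrelevant HookRows-irrelevant (hookRows-hookTableau t)

HookTriples↔S21Union : ∀ n → 2 ≤ n → HookTriples n ↔ S21Union n
HookTriples↔S21Union n 2≤n = mk↔ₛ′ toS21 (fromS21 2≤n) (toS21∘fromS21 2≤n) (fromS21∘toS21 2≤n)

corollary3p2 : (n : ℕ) → n ≥ 2 → HMUnion n ⤖ S21Union n
corollary3p2 n n≥2 = ↔⇒⤖ (begin
  HMUnion n          ↔⟨ HMUnion↔HumpedPaths n ⟩
  HumpedPaths n      ↔⟨ HumpedPaths↔HumpPiecesOfSize n ⟩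
  HumpPiecesOfSize n ↔⟨ HumpPiecesOfSize↔BallotPieces n ⟩
  BallotPieces n     ↔⟨ BallotPieces↔BallotWords n ⟩
  BallotWords n      ↔⟨ BallotWords↔HookTriples n ⟩
  HookTriples n      ↔⟨ HookTriples↔S21Union n n≥2 ⟩
  S21Union n         ∎)
  where open EquationalReasoning {k = bijection}
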